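{- Let $\ell_1,\ell_2\ge1$ be integers, let $\mathscr{M}=\{(a,b)\in\mathbb{Z}^2: 0\le a\le\ell_1-1,\ 0\le b\le\ell_2-1\}$ with the componentwise order, and let $\mathrm{wt}$ be a rank increasing and rank constant weight function on $\mathscr{M}$. Then: (1) if $\ell_1=\ell_2$, then $\mathcal{L}$ and $\mathcal{C}$ give the only nested solutions for $\mathscr{M}$; (2) if $\ell_1=1$ or $\ell_2=1$, then there is a unique total order on $\mathscr{M}$ extending the partial order, and hence $\mathcal{L}$ and $\mathcal{C}$ (which coincide) give the only nested solutions; (3) if $1<\ell_1<\ell_2$, then $\mathcal{L}$ gives the only nested solutions for $\mathscr{M}$; (4) if $1<\ell_2<\ell_1$, then $\mathcal{C}$ gives the only nested solutions for $\mathscr{M}$.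
   Context: The rank of $(a,b)$ is $a+b$; $\mathrm{wt}$ is rank constant if equal ranks give equal weights and rank increasing if strictly smaller rank gives strictly smaller weight; $\mathrm{wt}(S)=\sum_{s\in S}\mathrm{wt}(s)$. A downset is a subset closed downward in the componentwise order; it is optimal if its weight is at least that of every downset of the same size. $\mathcal{L}$: $(a,b)<(c,d)$ iff $a<c$, or $a=c$ and $b<d$. $\mathcal{C}$: $(a,b)<(c,d)$ iff $b<d$, or $b=d$ and $a<c$. A total order $\mathcal{O}$ on $\mathscr{M}$ gives nested solutions if for every $m\in\{0,\dots,\ell_1\ell_2\}$ the set of the $m$ smallest elements of $\mathcal{O}$ is an optimal downset; equivalently, a chain $A_0\subseteq A_1\subseteq\dots\subseteq A_{\ell_1\ell_2}$ of optimal downsets with $|A_i|=i$ is determined by such an order.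
   Formalization: The weight function wt takes values in the rationals instead of the reals. -}

module Defs where

open import Data.Nat using (ℕ; _+_)
open import Data.Fin using (Fin; toℕ)
open import Data.Product using (_×_; _,_; proj₁; proj₂)
open import Data.List using (List; []; _∷_; length; map; concatMap; allFin; take; lookup; foldr)
open import Data.List.Membership.Propositional using (_∈_)
open import Data.List.Relation.Unary.Unique.Propositional using (Unique)
open import Data.Rational using (ℚ; 0ℚ) renaming (_+_ to _+ℚ_; _≤_ to _≤ℚ_; _<_ to _<ℚ_)
import Data.Nat as N
open import Relation.Binary.PropositionalEquality using (_≡_)

𝓜 : ℕ → ℕ → Set
𝓜 ℓ₁ ℓ₂ = Fin ℓ₁ × Fin ℓ₂

_≼_ : ∀ {ℓ₁ ℓ₂} → 𝓜 ℓ₁ ℓ₂ → 𝓜 ℓ₁ ℓ₂ → Set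
(a , b) ≼ (c , d) = (toℕ a N.≤ toℕ c) × (toℕ b N.≤ toℕ d)

rank : ∀ {ℓ₁ ℓ₂} → 𝓜 ℓ₁ ℓ₂ → ℕ
rank (a , b) = toℕ a + toℕ b

Weight : ℕ → ℕ → Set
Weight ℓ₁ ℓ₂ = 𝓜 ℓ₁ ℓ₂ → ℚ

RankConstant : ∀ {ℓ₁ ℓ₂} → Weight ℓ₁ ℓ₂ → Set
RankConstant {ℓ₁} {ℓ₂} wt = (x y : 𝓜 ℓ₁ ℓ₂) → rank x ≡ rank y → wt x ≡ wt y

RankIncreasing : ∀ {ℓ₁ ℓ₂} → Weight ℓ₁ ℓ₂ → Set
RankIncreasing {ℓ₁} {ℓ₂} wt = (x y : 𝓜 ℓ₁ ℓ₂) → rank x N.< rank y → wt x <ℚ wt y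

-- finite subsets of 𝓜 are represented by duplicate-free lists
wtSum : ∀ {ℓ₁ ℓ₂} → Weight ℓ₁ ℓ₂ → List (𝓜 ℓ₁ ℓ₂) → ℚ
wtSum wt xs = foldr (λ x s → wt x +ℚ s) 0ℚ xs

IsDownset : ∀ {ℓ₁ ℓ₂} → List (𝓜 ℓ₁ ℓ₂) → Set
IsDownset {ℓ₁} {ℓ₂} S = Unique S × ((x y : 𝓜 ℓ₁ ℓ₂) → x ∈ S → y ≼ x → y ∈ S)

IsOptimalDownset : ∀ {ℓ₁ ℓ₂} → Weight ℓ₁ ℓ₂ → List (𝓜 ℓ₁ ℓ₂) → Set
IsOptimalDownset {ℓ₁} {ℓ₂} wt S =
  IsDownset S × ((T : List (𝓜 ℓ₁ ℓ₂)) → IsDownset T → length T ≡ length S → wtSum wt T ≤ℚ wtSum wt S)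

-- a total order on 𝓜, given as the enumeration of 𝓜 from smallest to largest
-- (a duplicate-free list containing every element)
IsTotalOrder : ∀ {ℓ₁ ℓ₂} → List (𝓜 ℓ₁ ℓ₂) → Set
IsTotalOrder {ℓ₁} {ℓ₂} O = Unique O × ((x : 𝓜 ℓ₁ ℓ₂) → x ∈ O)

IsLinearExtension : ∀ {ℓ₁ ℓ₂} → List (𝓜 ℓ₁ ℓ₂) → Set
IsLinearExtension O = IsTotalOrder O ×
  ((i j : Fin (length O)) → lookup O i ≼ lookup O j → toℕ i N.≤ toℕ j)

GivesNestedSolutions : ∀ {ℓ₁ ℓ₂} → Weight ℓ₁ ℓ₂ → List (𝓜 ℓ₁ ℓ₂) → Set
GivesNestedSolutions {ℓ₁} {ℓ₂} wt O =
  (m : ℕ) → m N.≤ ℓ₁ N.* ℓ₂ → IsOptimalDownset wt (take m O)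

𝓛 : (ℓ₁ ℓ₂ : ℕ) → List (𝓜 ℓ₁ ℓ₂)
𝓛 ℓ₁ ℓ₂ = concatMap (λ a → map (λ b → (a , b)) (allFin ℓ₂)) (allFin ℓ₁)

𝓒 : (ℓ₁ ℓ₂ : ℕ) → List (𝓜 ℓ₁ ℓ₂)
𝓒 ℓ₁ ℓ₂ = concatMap (λ b → map (λ a → (a , b)) (allFin ℓ₁)) (allFin ℓ₂)

module Submission where

-- For a downset T with column heights h_b (cells (a , b) with a < h_b), put x_b = b + h_b.
-- The number of cells of T of rank at least j is Σ_b (x_b ∸ j) - Σ_b (b ∸ j), and since the
-- weight is an increasing function of the rank, T weighs no more than any downset of the same
-- size having at least as many cells of rank ≥ j for every j.  When ℓ₁ ≤ ℓ₂ the sequence x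
-- never skips a value lying between two of its values, while for the 𝓛-prefix of the same
-- size x_b is k + b or k + b + 1.  Comparing, level by level, how many x_b reach the level,
-- the two counts cross at most once; with equal totals this bounds every tail sum, so the
-- 𝓛-prefixes are optimal.  By transposition 𝓒-prefixes are optimal when ℓ₂ ≤ ℓ₁.
--
-- Conversely, the prefixes of an order O giving nested solutions weigh the same as those of 𝓛,
-- so O has the rank of 𝓛 at every position.  An enumeration with downward closed prefixes and
-- this rank sequence is 𝓛, except that it may start (0 , 0) , (1 , 0): then (0 , 1) comes after
-- the whole of row 0 of 𝓛, the last position of that row is filled by (ℓ₂ - 1 , 0), and ℓ₁ = ℓ₂.
-- On a square grid this exception is, after transposition, the order 𝓒.  When ℓ₁ = 1 or
-- ℓ₂ = 1 the rank is injective, so a linear extension lists the cells by increasing rank.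

open import Data.Nat
open import Data.Nat.Properties
open import Data.Nat.Induction using (<-rec)
open import Data.Product using (∃; _×_; _,_; proj₁; proj₂; swap)
open import Data.Sum using (_⊎_; inj₁; inj₂) renaming ([_,_]′ to ⊎-elim)
open import Data.Empty using (⊥; ⊥-elim)
open import Data.Fin using (Fin; toℕ; fromℕ<; zero; suc)
open import Data.Fin.Properties using (toℕ-injective; toℕ<n; toℕ-fromℕ<)
open import Data.List
  using (List; []; _∷_; [_]; _++_; length; foldr; map; take; lookup; tabulate; applyUpTo; upTo; concatMap; allFin)
open import Data.List.Properties
  using ( length-take; length-map; length-upTo; map-tabulate; map-id; map-∘; take-map; upTo-∷ʳ; ++-identityʳ
        ; concatMap-pure; map-concatMap; concatMap-cong; concatMap-map; concatMap-++ )
open import Data.List.Membership.Propositional using (_∈_; find; lose)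
open import Data.List.Membership.Propositional.Properties using (∈-map⁺; ∈-map⁻)
open import Data.List.Relation.Unary.Any using (Any; here; there; _─_; any?)
import Data.List.Relation.Unary.All as All
open import Data.List.Relation.Unary.AllPairs using ([]; _∷_)
open import Data.List.Relation.Unary.Unique.Propositional using (Unique)
import Data.List.Relation.Unary.Unique.Propositional.Properties as Unique
open import Data.List.Extrema.Nat using (argmax; argmax-sel; f[⊥]≤f[argmax]; f[xs]≤f[argmax])
import Data.Rational as ℚ
open ℚ using (ℚ)
import Data.Rational.Properties as ℚ
open import Algebra.Bundles using (CommutativeMonoid)
import Algebra.Properties.Group as Group
open import Algebra.Properties.CommutativeSemigroup +-commutativeSemigroup
  using () renaming (interchange to +-interchange; x∙yz≈y∙xz to x+yz≡y+xz)
open import Algebra.Properties.CommutativeSemigroup (CommutativeMonoid.commutativeSemigroup ℚ.+-0-commutativeMonoid)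
  using () renaming (x∙yz≈y∙xz to x+yz≡y+xzℚ)
open import Function using (_∘_)
open import Function.Bundles using (_⇔_; mk⇔; Equivalence)
open import Relation.Nullary using (Dec; yes; no; ¬_; contradiction)
open import Relation.Nullary.Decidable using (_×-dec_)
open import Relation.Binary using (tri<; tri≈; tri>)
open import Relation.Binary.PropositionalEquality hiding ([_])

open import Defs

Σ< : ℕ → (ℕ → ℕ) → ℕ
Σ< zero    f = 0
Σ< (suc n) f = Σ< n f + f n

Σ<-cong : ∀ n {f g : ℕ → ℕ} → (∀ i → i < n → f i ≡ g i) → Σ< n f ≡ Σ< n g
Σ<-cong zero    f≡g = refl
Σ<-cong (suc n) f≡g = cong₂ _+_ (Σ<-cong n λ i i<n → f≡g i (m<n⇒m<1+n i<n)) (f≡g n ≤-refl)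

Σ<-mono-≤ : ∀ n {f g : ℕ → ℕ} → (∀ i → i < n → f i ≤ g i) → Σ< n f ≤ Σ< n g
Σ<-mono-≤ zero    f≤g = z≤n
Σ<-mono-≤ (suc n) f≤g = +-mono-≤ (Σ<-mono-≤ n λ i i<n → f≤g i (m<n⇒m<1+n i<n)) (f≤g n ≤-refl)

Σ<-distrib-+ : ∀ n (f g : ℕ → ℕ) → Σ< n (λ i → f i + g i) ≡ Σ< n f + Σ< n g
Σ<-distrib-+ zero    f g = refl
Σ<-distrib-+ (suc n) f g =
  trans (cong (_+ (f n + g n)) (Σ<-distrib-+ n f g)) (+-interchange (Σ< n f) (Σ< n g) (f n) (g n))

Σ<-const : ∀ n c → Σ< n (λ _ → c) ≡ n * c
Σ<-const zero    c = refl
Σ<-const (suc n) c = trans (cong (_+ c) (Σ<-const n c)) (+-comm (n * c) c)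

Σ<-zero : ∀ n {f : ℕ → ℕ} → (∀ i → i < n → f i ≡ 0) → Σ< n f ≡ 0
Σ<-zero n f≡0 = trans (Σ<-cong n f≡0) (trans (Σ<-const n 0) (*-zeroʳ n))

Σ<-*-distribˡ : ∀ n c (f : ℕ → ℕ) → c * Σ< n f ≡ Σ< n (λ i → c * f i)
Σ<-*-distribˡ zero    c f = *-zeroʳ c
Σ<-*-distribˡ (suc n) c f = trans (*-distribˡ-+ c (Σ< n f) (f n)) (cong (_+ c * f n) (Σ<-*-distribˡ n c f))

term≤Σ< : ∀ n (f : ℕ → ℕ) {i} → i < n → f i ≤ Σ< n f
term≤Σ< (suc n) f {i} i<1+n with m≤n⇒m<n∨m≡n (s≤s⁻¹ i<1+n)
... | inj₁ i<n  = ≤-trans (term≤Σ< n f i<n) (m≤m+n _ _)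
... | inj₂ refl = m≤n+m _ _

𝟙 : {P : Set} → Dec P → ℕ
𝟙 (yes _) = 1
𝟙 (no _)  = 0

𝟙≤1 : {P : Set} (d : Dec P) → 𝟙 d ≤ 1
𝟙≤1 (yes _) = ≤-refl
𝟙≤1 (no _)  = z≤n

𝟙-yes : {P : Set} (d : Dec P) → P → 𝟙 d ≡ 1
𝟙-yes (yes _) _  = refl
𝟙-yes (no ¬p) p = ⊥-elim (¬p p)

𝟙-no : {P : Set} (d : Dec P) → ¬ P → 𝟙 d ≡ 0
𝟙-no (yes p) ¬p = ⊥-elim (¬p p)
𝟙-no (no _)  _  = refl

𝟙-cong : {P Q : Set} (d : Dec P) (e : Dec Q) → P ⇔ Q → 𝟙 d ≡ 𝟙 e
𝟙-cong (yes _) (yes _) _   = refl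
𝟙-cong (yes p) (no ¬q) P⇔Q = ⊥-elim (¬q (Equivalence.to P⇔Q p))
𝟙-cong (no ¬p) (yes q) P⇔Q = ⊥-elim (¬p (Equivalence.from P⇔Q q))
𝟙-cong (no _)  (no _)  _   = refl

count< : (n : ℕ) {P : ℕ → Set} → (∀ i → Dec (P i)) → ℕ
count< n P? = Σ< n (λ i → 𝟙 (P? i))

module _ {P : ℕ → Set} (P? : ∀ i → Dec (P i)) where

  count<≤ : ∀ n → count< n P? ≤ n
  count<≤ zero    = z≤n
  count<≤ (suc n) = subst (_≤ suc n) (+-comm (𝟙 (P? n)) _) (+-mono-≤ (𝟙≤1 (P? n)) (count<≤ n))

  count<-all : ∀ n → (∀ i → i < n → P i) → count< n P? ≡ n
  count<-all n all = begin
    count< n P?      ≡⟨ Σ<-cong n (λ i i<n → 𝟙-yes (P? i) (all i i<n)) ⟩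
    Σ< n (λ _ → 1)   ≡⟨ Σ<-const n 1 ⟩
    n * 1            ≡⟨ *-identityʳ n ⟩
    n                ∎
    where open ≡-Reasoning

  count<<n⇒∃¬ : ∀ n → count< n P? < n → ∃ λ i → i < n × ¬ P i
  count<<n⇒∃¬ (suc n) c<1+n with P? n
  ... | no ¬p = n , ≤-refl , ¬p
  ... | yes _ with count<<n⇒∃¬ n (s≤s⁻¹ (subst (_< suc n) (+-comm (count< n P?) 1) c<1+n))
  ...   | i , i<n , ¬p = i , m<n⇒m<1+n i<n , ¬p

  0<count<⇒∃ : ∀ n → 0 < count< n P? → ∃ λ i → i < n × P i
  0<count<⇒∃ (suc n) 0<c with P? n
  ... | yes p = n , ≤-refl , p
  ... | no _ with 0<count<⇒∃ n (subst (0 <_) (+-identityʳ (count< n P?)) 0<c)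
  ...   | i , i<n , p = i , m<n⇒m<1+n i<n , p

  P⇔<count< : ∀ n → (∀ a a′ → P a → a′ ≤ a → P a′) → (∀ a → P a → a < n) →
             ∀ a → P a ⇔ a < count< n P?
  P⇔<count< zero    _    bound a = mk⇔ (λ p → contradiction (bound a p) λ ()) λ ()
  P⇔<count< (suc n) down bound a with P? n
  ... | yes pn = subst (λ c → P a ⇔ a < c) (sym count≡) (mk⇔ (bound a) λ a<1+n → down n a pn (s≤s⁻¹ a<1+n))
    where
    count≡ : count< n P? + 1 ≡ suc n
    count≡ = trans (cong (_+ 1) (count<-all n λ i i<n → down n i pn (<⇒≤ i<n))) (+-comm n 1)
  ... | no ¬pn = subst (λ c → P a ⇔ a < c) (sym (+-identityʳ _)) (P⇔<count< n down bound′ a)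
    where
    bound′ : ∀ a → P a → a < n
    bound′ a p with m≤n⇒m<n∨m≡n (s≤s⁻¹ (bound a p))
    ... | inj₁ a<n  = a<n
    ... | inj₂ refl = contradiction p ¬pn

Σ<-point : ∀ n {i} (g : ℕ → ℕ) → i < n → Σ< n (λ a → 𝟙 (i ≟ a) * g a) ≡ g i
Σ<-point (suc n) {i} g i<1+n with m≤n⇒m<n∨m≡n (s≤s⁻¹ i<1+n)
... | inj₁ i<n  = trans (cong₂ _+_ (Σ<-point n g i<n) (cong (_* g n) (𝟙-no (i ≟ n) λ { refl → <-irrefl refl i<n })))
                        (+-identityʳ (g i))
... | inj₂ refl = trans (cong₂ _+_ (Σ<-zero i λ a a<i → cong (_* g a) (𝟙-no (i ≟ a) λ { refl → <-irrefl refl a<i }))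
                                   (cong (_* g i) (𝟙-yes (i ≟ i) refl)))
                        (+-identityʳ (g i))

Σ<-initial : ∀ n {m} (g : ℕ → ℕ) → m ≤ n → Σ< n (λ a → 𝟙 (a <? m) * g a) ≡ Σ< m g
Σ<-initial zero    g z≤n = refl
Σ<-initial (suc n) {m} g m≤1+n with m≤n⇒m<n∨m≡n m≤1+n
... | inj₁ m<1+n = trans (cong₂ _+_ (Σ<-initial n g m≤n) (cong (_* g n) (𝟙-no (n <? m) λ n<m → n≮n n (<-≤-trans n<m m≤n))))
                         (+-identityʳ (Σ< m g))
  where m≤n = s≤s⁻¹ m<1+n
... | inj₂ refl  = cong₂ _+_ (Σ<-cong n λ a a<n → trans (cong (_* g a) (𝟙-yes (a <? suc n) (m<n⇒m<1+n a<n)))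
                                                        (+-identityʳ (g a)))
                             (trans (cong (_* g n) (𝟙-yes (n <? suc n) ≤-refl)) (+-identityʳ (g n)))

∸-∸-suc≤ : ∀ m n k → (m ∸ k) ∸ (n ∸ suc k) ≤ suc (m ∸ n)
∸-∸-suc≤ m       zero    k       = ≤-trans (m∸n≤m m k) (n≤1+n m)
∸-∸-suc≤ zero    (suc n) zero    = subst (_≤ suc (0 ∸ suc n)) (sym (0∸n≡0 n)) z≤n
∸-∸-suc≤ zero    (suc n) (suc k) = subst (_≤ suc (0 ∸ suc n)) (sym (0∸n≡0 (n ∸ suc k))) z≤n
∸-∸-suc≤ (suc m) (suc n) zero    =
  m≤n+o⇒m∸n≤o (suc m) n (subst (suc m ≤_) (sym (+-suc n (m ∸ n))) (s≤s (m≤n+m∸n m n)))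
∸-∸-suc≤ (suc m) (suc n) (suc k) = ∸-∸-suc≤ m n k

module _ (s e : ℕ) where

  between? : ∀ b → Dec (s ≤ b × b < e)
  between? b = (s ≤? b) ×-dec (b <? e)

  private
    count<-between≤∸ : ∀ n → count< n between? ≤ n ∸ s
    count<-between≤∸ zero    = z≤n
    count<-between≤∸ (suc n) = step (s ≤? n)
      where
      open ≤-Reasoning
      step : Dec (s ≤ n) → count< (suc n) between? ≤ suc n ∸ s
      step (yes s≤n) = begin
        count< n between? + 𝟙 (between? n)  ≤⟨ +-mono-≤ (count<-between≤∸ n) (𝟙≤1 (between? n)) ⟩
        n ∸ s + 1                           ≡⟨ +-comm (n ∸ s) 1 ⟩
        suc (n ∸ s)                         ≡⟨ +-∸-assoc 1 s≤n ⟨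
        suc n ∸ s                           ∎
      step (no s≰n) = begin
        count< n between? + 𝟙 (between? n)  ≡⟨ cong (count< n between? +_) (𝟙-no (between? n) (s≰n ∘ proj₁)) ⟩
        count< n between? + 0               ≡⟨ +-identityʳ _ ⟩
        count< n between?                   ≤⟨ count<-between≤∸ n ⟩
        n ∸ s                               ≤⟨ ∸-monoˡ-≤ s (n≤1+n n) ⟩
        suc n ∸ s                           ∎

  count<-between≤ : ∀ n → count< n between? ≤ e ∸ s
  count<-between≤ zero    = z≤n
  count<-between≤ (suc n) = step (n <? e)
    where
    open ≤-Reasoning
    step : Dec (n < e) → count< (suc n) between? ≤ e ∸ s
    step (yes n<e) = ≤-trans (count<-between≤∸ (suc n)) (∸-monoˡ-≤ s n<e)
    step (no n≮e)  = begin
      count< n between? + 𝟙 (between? n)  ≡⟨ cong (count< n between? +_) (𝟙-no (between? n) (n≮e ∘ proj₂)) ⟩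
      count< n between? + 0               ≡⟨ +-identityʳ _ ⟩
      count< n between?                   ≤⟨ count<-between≤ n ⟩
      e ∸ s                               ∎

module Majorization (ℓ : ℕ) where

  atLeast : (ℕ → ℕ) → ℕ → ℕ
  atLeast f v = count< ℓ (λ b → v ≤? f b)

  excess : (ℕ → ℕ) → ℕ → ℕ
  excess f j = Σ< ℓ (λ b → f b ∸ j)

  Attained : (ℕ → ℕ) → ℕ → Set
  Attained f w = ∃ λ b → b < ℓ × f b ≡ w

  Gapless : (ℕ → ℕ) → Set
  Gapless f = ∀ {w b₁ b₂} → b₁ < ℓ → b₂ < ℓ → f b₁ ≤ w → w ≤ f b₂ → Attained f w

  NearlyArithmetic : (ℕ → ℕ) → ℕ → Set
  NearlyArithmetic f k = ∀ b → b < ℓ → k + b ≤ f b × f b ≤ suc (k + b)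

  excess-suc : ∀ f j → excess f j ≡ atLeast f (suc j) + excess f (suc j)
  excess-suc f j = trans (Σ<-cong ℓ λ b _ → ∸≡𝟙+∸suc (f b)) (Σ<-distrib-+ ℓ _ _)
    where
    ∸≡𝟙+∸suc : ∀ w → w ∸ j ≡ 𝟙 (suc j ≤? w) + (w ∸ suc j)
    ∸≡𝟙+∸suc w with suc j ≤? w
    ... | yes (s≤s j≤w′) = +-∸-assoc 1 j≤w′
    ... | no j≮w = trans (m≤n⇒m∸n≡0 w≤j) (sym (m≤n⇒m∸n≡0 (m≤n⇒m≤1+n w≤j)))
      where w≤j = s≤s⁻¹ (≰⇒> j≮w)

  excess-unroll : ∀ f j t → excess f j ≡ Σ< t (λ s → atLeast f (suc (j + s))) + excess f (j + t)
  excess-unroll f j zero    = cong (excess f) (sym (+-identityʳ j))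
  excess-unroll f j (suc t) = begin
    excess f j                                    ≡⟨ excess-unroll f j t ⟩
    S + excess f (j + t)                          ≡⟨ cong (S +_) (excess-suc f (j + t)) ⟩
    S + (atLeast f (suc (j + t)) + excess f (suc (j + t)))
                                                  ≡⟨ +-assoc S _ _ ⟨
    S + atLeast f (suc (j + t)) + excess f (suc (j + t))
                                                  ≡⟨ cong (λ i → S + atLeast f (suc (j + t)) + excess f i) (+-suc j t) ⟨
    S + atLeast f (suc (j + t)) + excess f (j + suc t) ∎
    where
    open ≡-Reasoning
    S = Σ< t (λ s → atLeast f (suc (j + s)))

  excess≡0 : ∀ f {J} → (∀ b → b < ℓ → f b ≤ J) → excess f J ≡ 0
  excess≡0 f f≤J = Σ<-zero ℓ λ b b<ℓ → m≤n⇒m∸n≡0 (f≤J b b<ℓ)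

  atLeast-suc : ∀ f w → atLeast f w ≡ count< ℓ (λ b → f b ≟ w) + atLeast f (suc w)
  atLeast-suc f w = trans (Σ<-cong ℓ λ b _ → split (f b)) (Σ<-distrib-+ ℓ _ _)
    where
    split : ∀ z → 𝟙 (w ≤? z) ≡ 𝟙 (z ≟ w) + 𝟙 (suc w ≤? z)
    split z with <-cmp z w
    ... | tri< z<w z≢w _ = trans (𝟙-no (w ≤? z) (<⇒≱ z<w))
                                 (sym (cong₂ _+_ (𝟙-no (z ≟ w) z≢w) (𝟙-no (suc w ≤? z) (<⇒≱ (m<n⇒m<1+n z<w)))))
    ... | tri≈ _ refl _  = trans (𝟙-yes (w ≤? w) ≤-refl)
                                 (sym (cong₂ _+_ (𝟙-yes (w ≟ w) refl) (𝟙-no (suc w ≤? w) (n≮n w))))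
    ... | tri> _ _ w<z   = trans (𝟙-yes (w ≤? z) (<⇒≤ w<z))
                                 (sym (cong₂ _+_ (𝟙-no (z ≟ w) (>⇒≢ w<z)) (𝟙-yes (suc w ≤? z) w<z)))

  atLeast-drop-≥ : ∀ f v d → (∀ w → v ≤ w → w < v + d → Attained f w) → d + atLeast f (v + d) ≤ atLeast f v
  atLeast-drop-≥ f v zero    _        = ≤-reflexive (cong (atLeast f) (+-identityʳ v))
  atLeast-drop-≥ f v (suc d) attained = begin
    suc d + atLeast f (v + suc d)                           ≡⟨ cong (λ i → suc d + atLeast f i) (+-suc v d) ⟩
    1 + (d + atLeast f (suc v + d))                         ≤⟨ +-mono-≤ attained-v (atLeast-drop-≥ f (suc v) d attained′) ⟩
    count< ℓ (λ b → f b ≟ v) + atLeast f (suc v)            ≡⟨ atLeast-suc f v ⟨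
    atLeast f v                                             ∎
    where
    open ≤-Reasoning
    attained-v : 1 ≤ count< ℓ (λ b → f b ≟ v)
    attained-v with attained v ≤-refl (subst (v <_) (sym (+-suc v d)) (s≤s (m≤m+n v d)))
    ... | b , b<ℓ , fb≡v =
      ≤-trans (≤-reflexive (sym (𝟙-yes (f b ≟ v) fb≡v))) (term≤Σ< ℓ (λ b → 𝟙 (f b ≟ v)) b<ℓ)
    attained′ : ∀ w → suc v ≤ w → w < suc v + d → Attained f w
    attained′ w v<w w<v+d = attained w (<⇒≤ v<w) (subst (w <_) (sym (+-suc v d)) w<v+d)

  atLeast-drop-≤ : ∀ f k → NearlyArithmetic f k → ∀ v₀ v₁ → atLeast f v₀ ≤ suc (v₁ ∸ v₀) + atLeast f v₁
  atLeast-drop-≤ f k arith v₀ v₁ = begin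
    atLeast f v₀                                     ≤⟨ Σ<-mono-≤ ℓ split ⟩
    Σ< ℓ (λ b → 𝟙 (window b) + 𝟙 (v₁ ≤? f b))        ≡⟨ Σ<-distrib-+ ℓ _ _ ⟩
    count< ℓ window + atLeast f v₁                   ≤⟨ +-monoˡ-≤ (atLeast f v₁) (count<-between≤ _ _ ℓ) ⟩
    (v₁ ∸ k) ∸ (v₀ ∸ suc k) + atLeast f v₁           ≤⟨ +-monoˡ-≤ (atLeast f v₁) (∸-∸-suc≤ v₁ v₀ k) ⟩
    suc (v₁ ∸ v₀) + atLeast f v₁                     ∎
    where
    open ≤-Reasoning
    window = between? (v₀ ∸ suc k) (v₁ ∸ k)
    split : ∀ b → b < ℓ → 𝟙 (v₀ ≤? f b) ≤ 𝟙 (window b) + 𝟙 (v₁ ≤? f b)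
    split b b<ℓ with v₁ ≤? f b | v₀ ≤? f b
    ... | yes _   | d       = ≤-trans (𝟙≤1 d) (m≤n+m 1 _)
    ... | no _    | no _    = z≤n
    ... | no v₁≰ | yes v₀≤ = ≤-trans (≤-reflexive (sym (𝟙-yes (window b) (lower , upper)))) (m≤m+n _ _)
      where
      lower : v₀ ∸ suc k ≤ b
      lower = ≤-trans (∸-monoˡ-≤ (suc k) (≤-trans v₀≤ (proj₂ (arith b b<ℓ)))) (≤-reflexive (m+n∸m≡n k b))
      upper : b < v₁ ∸ k
      upper = subst (_< v₁ ∸ k) (m+n∸m≡n k b) (∸-monoˡ-< (≤-<-trans (proj₁ (arith b b<ℓ)) (≰⇒> v₁≰)) (m≤m+n k b))

  -- From v₀ to v₁ the count for the gapless x drops by at least one per level, while the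
  -- count for the nearly arithmetic y drops by at most v₁ - v₀ + 1 altogether.
  no-crossing : ∀ x y k → Gapless x → NearlyArithmetic y k → ∀ {v₀ v₁} → v₀ ≤ v₁ →
                atLeast x v₀ < atLeast y v₀ → atLeast y v₁ < atLeast x v₁ → ⊥
  no-crossing x y k gapless arith {v₀} {v₁} v₀≤v₁ x<y y<x = <-irrefl refl (begin-strict
    (v₁ ∸ v₀) + atLeast x v₁                 ≡⟨ cong (λ i → (v₁ ∸ v₀) + atLeast x i) (m+[n∸m]≡n v₀≤v₁) ⟨
    (v₁ ∸ v₀) + atLeast x (v₀ + (v₁ ∸ v₀))   ≤⟨ atLeast-drop-≥ x v₀ (v₁ ∸ v₀) attained ⟩
    atLeast x v₀                             <⟨ x<y ⟩
    atLeast y v₀                             ≤⟨ atLeast-drop-≤ y k arith v₀ v₁ ⟩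
    suc (v₁ ∸ v₀) + atLeast y v₁             ≡⟨ +-suc (v₁ ∸ v₀) _ ⟨
    (v₁ ∸ v₀) + suc (atLeast y v₁)           ≤⟨ +-monoʳ-≤ (v₁ ∸ v₀) y<x ⟩
    (v₁ ∸ v₀) + atLeast x v₁                 ∎)
    where
    open ≤-Reasoning
    attained : ∀ w → v₀ ≤ w → w < v₀ + (v₁ ∸ v₀) → Attained x w
    attained w v₀≤w w<v₁ with count<<n⇒∃¬ (λ b → v₀ ≤? x b) ℓ (<-≤-trans x<y (count<≤ _ ℓ))
                            | 0<count<⇒∃ (λ b → v₁ ≤? x b) ℓ (≤-<-trans z≤n y<x)
    ... | b₁ , b₁<ℓ , v₀≰xb₁ | b₂ , b₂<ℓ , v₁≤xb₂ =
      gapless b₁<ℓ b₂<ℓ (≤-trans (<⇒≤ (≰⇒> v₀≰xb₁)) v₀≤w)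
                        (≤-trans (<⇒≤ (subst (w <_) (m+[n∸m]≡n v₀≤v₁) w<v₁)) v₁≤xb₂)

  -- Either atLeast x < atLeast y at some level up to j, and then atLeast x ≤ atLeast y at
  -- every level above j, or atLeast x ≥ atLeast y at all levels up to j, and the equal
  -- totals transfer this to the levels above j.
  excess-≤ : ∀ x y → excess x 0 ≡ excess y 0 →
             (∀ {v₀ v₁} → v₀ ≤ v₁ → atLeast x v₀ < atLeast y v₀ → atLeast y v₁ < atLeast x v₁ → ⊥) →
             ∀ j → excess x j ≤ excess y j
  excess-≤ x y total≡ no-cross j with anyUpTo? (λ v → atLeast x (suc v) <? atLeast y (suc v)) j
  ... | no never = +-cancelˡ-≤ (head y) _ _ (begin
    head y + excess x j   ≤⟨ +-monoˡ-≤ (excess x j) (Σ<-mono-≤ j λ v v<j → ≮⇒≥ λ lt → never (v , v<j , lt)) ⟩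
    head x + excess x j   ≡⟨ excess-unroll x 0 j ⟨
    excess x 0            ≡⟨ total≡ ⟩
    excess y 0            ≡⟨ excess-unroll y 0 j ⟩
    head y + excess y j   ∎)
    where
    open ≤-Reasoning
    head : (ℕ → ℕ) → ℕ
    head f = Σ< j (λ s → atLeast f (suc s))
  ... | yes (v , v<j , x<y) = begin
    excess x j                  ≡⟨ excess-unroll x j M ⟩
    tail x + excess x (j + M)   ≡⟨ cong (tail x +_) (excess≡0 x λ b b<ℓ → ≤-trans (term≤Σ< ℓ x b<ℓ) (m≤n+m M j)) ⟩
    tail x + 0                  ≤⟨ +-mono-≤ (Σ<-mono-≤ M λ s _ → ≮⇒≥ (no-cross (v≤j+ s) x<y)) z≤n ⟩
    tail y + excess y (j + M)   ≡⟨ excess-unroll y j M ⟨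
    excess y j                  ∎
    where
    open ≤-Reasoning
    M = Σ< ℓ x
    v≤j+ : ∀ s → suc v ≤ suc (j + s)
    v≤j+ s = s≤s (≤-trans (<⇒≤ v<j) (m≤m+n j s))
    tail : (ℕ → ℕ) → ℕ
    tail f = Σ< M (λ s → atLeast f (suc (j + s)))

module RankCounts {A : Set} (rank : A → ℕ) where

  #rank≥ : ℕ → List A → ℕ
  #rank≥ j []       = 0
  #rank≥ j (x ∷ xs) = 𝟙 (j ≤? rank x) + #rank≥ j xs

  0<#rank≥⇒∃ : ∀ j xs → 0 < #rank≥ j xs → ∃ λ y → y ∈ xs × j ≤ rank y
  0<#rank≥⇒∃ j (x ∷ xs) 0<# with j ≤? rank x
  ... | yes j≤x = x , here refl , j≤x
  ... | no _ with 0<#rank≥⇒∃ j xs 0<#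
  ...   | y , y∈xs , j≤y = y , there y∈xs , j≤y

  #rank≥≡0 : ∀ j xs → (∀ {y} → y ∈ xs → rank y < j) → #rank≥ j xs ≡ 0
  #rank≥≡0 j []       _     = refl
  #rank≥≡0 j (x ∷ xs) below = cong₂ _+_ (𝟙-no (j ≤? rank x) (<⇒≱ (below (here refl))))
                                       (#rank≥≡0 j xs (below ∘ there))

  #rank≥-─ : ∀ j {xs : List A} {m} (m∈xs : m ∈ xs) → #rank≥ j xs ≡ 𝟙 (j ≤? rank m) + #rank≥ j (xs ─ m∈xs)
  #rank≥-─ j (here refl)          = refl
  #rank≥-─ j {x ∷ xs} {m} (there m∈xs) = trans (cong (𝟙 (j ≤? rank x) +_) (#rank≥-─ j m∈xs))
                                               (x+yz≡y+xz (𝟙 (j ≤? rank x)) (𝟙 (j ≤? rank m)) _)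

  maxRank : (x : A) (xs : List A) → ∃ λ m → m ∈ x ∷ xs × (∀ {y} → y ∈ x ∷ xs → rank y ≤ rank m)
  maxRank x xs = argmax rank x xs , argmax∈ , bound
    where
    argmax∈ : argmax rank x xs ∈ x ∷ xs
    argmax∈ with argmax-sel rank x xs
    ... | inj₁ ≡x   = here ≡x
    ... | inj₂ ∈xs = there ∈xs
    bound : ∀ {y} → y ∈ x ∷ xs → rank y ≤ rank (argmax rank x xs)
    bound (here refl)  = f[⊥]≤f[argmax] {f = rank} x xs
    bound (there y∈xs) = All.lookup (f[xs]≤f[argmax] {f = rank} x xs) y∈xs

  module _ (w : A → ℚ) where

    wsum : List A → ℚ
    wsum = foldr (λ x s → w x ℚ.+ s) ℚ.0ℚ

    wsum-─ : ∀ {xs : List A} {m} (m∈xs : m ∈ xs) → wsum xs ≡ w m ℚ.+ wsum (xs ─ m∈xs)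
    wsum-─ (here refl)                = refl
    wsum-─ {x ∷ xs} {m} (there m∈xs) = trans (cong (w x ℚ.+_) (wsum-─ m∈xs)) (x+yz≡y+xzℚ (w x) (w m) _)

    private
      ∈-─⁻ : ∀ {xs : List A} {m y} (m∈xs : m ∈ xs) → y ∈ (xs ─ m∈xs) → y ∈ xs
      ∈-─⁻ (here refl)  y∈         = there y∈
      ∈-─⁻ (there m∈xs) (here refl) = here refl
      ∈-─⁻ (there m∈xs) (there y∈)  = there (∈-─⁻ m∈xs y∈)

      length-─ : ∀ {xs : List A} {m} (m∈xs : m ∈ xs) → length xs ≡ suc (length (xs ─ m∈xs))
      length-─ (here refl)  = refl
      length-─ (there m∈xs) = cong suc (length-─ m∈xs)

    -- By induction on the length: a maximal-rank element of xs has rank at most that of a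
    -- maximal-rank element of ys, and removing both preserves the hypothesis.
    wsum-≤ : (∀ {x y} → rank x ≤ rank y → w x ℚ.≤ w y) →
             ∀ n xs ys → length xs ≡ n → length ys ≡ n → (∀ j → #rank≥ j xs ≤ #rank≥ j ys) → wsum xs ℚ.≤ wsum ys
    wsum-≤ w-mono zero    []       []       _    _    _   = ℚ.≤-refl
    wsum-≤ w-mono (suc n) (x ∷ xs) (y ∷ ys) |xs| |ys| dom with maxRank x xs | maxRank y ys
    ... | mx , mx∈ , mx-max | my , my∈ , my-max =
      subst₂ ℚ._≤_ (sym (wsum-─ mx∈)) (sym (wsum-─ my∈))
        (ℚ.+-mono-≤ (w-mono mx≤my) (wsum-≤ w-mono n (x ∷ xs ─ mx∈) (y ∷ ys ─ my∈)
                                     (suc-injective (trans (sym (length-─ mx∈)) |xs|))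
                                     (suc-injective (trans (sym (length-─ my∈)) |ys|)) dom′))
      where
      counted : ∀ {j} → j ≤ rank mx → #rank≥ j (x ∷ xs) ≡ suc (#rank≥ j (x ∷ xs ─ mx∈))
      counted {j} j≤mx = trans (#rank≥-─ j mx∈) (cong (_+ #rank≥ j (x ∷ xs ─ mx∈)) (𝟙-yes (j ≤? rank mx) j≤mx))
      mx≤my : rank mx ≤ rank my
      mx≤my with 0<#rank≥⇒∃ (rank mx) (y ∷ ys)
                   (<-≤-trans (s≤s z≤n) (subst (_≤ #rank≥ (rank mx) (y ∷ ys)) (counted ≤-refl) (dom (rank mx))))
      ... | y′ , y′∈ , mx≤y′ = ≤-trans mx≤y′ (my-max y′∈)
      dom′ : ∀ j → #rank≥ j (x ∷ xs ─ mx∈) ≤ #rank≥ j (y ∷ ys ─ my∈)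
      dom′ j with j ≤? rank mx
      ... | yes j≤mx = s≤s⁻¹ (begin
        suc (#rank≥ j (x ∷ xs ─ mx∈))  ≡⟨ counted j≤mx ⟨
        #rank≥ j (x ∷ xs)              ≤⟨ dom j ⟩
        #rank≥ j (y ∷ ys)              ≡⟨ #rank≥-─ j my∈ ⟩
        𝟙 (j ≤? rank my) + #rank≥ j (y ∷ ys ─ my∈)
          ≡⟨ cong (_+ #rank≥ j (y ∷ ys ─ my∈)) (𝟙-yes (j ≤? rank my) (≤-trans j≤mx mx≤my)) ⟩
        suc (#rank≥ j (y ∷ ys ─ my∈))  ∎)
        where open ≤-Reasoning
      ... | no j≰mx = subst (_≤ #rank≥ j (y ∷ ys ─ my∈))
                            (sym (#rank≥≡0 j _ λ y∈ → ≤-<-trans (mx-max (∈-─⁻ mx∈ y∈)) (≰⇒> j≰mx))) z≤n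

fstℕ sndℕ : ∀ {ℓ₁ ℓ₂} → 𝓜 ℓ₁ ℓ₂ → ℕ
fstℕ c = toℕ (proj₁ c)
sndℕ c = toℕ (proj₂ c)

cell-≡ : ∀ {ℓ₁ ℓ₂} {c c′ : 𝓜 ℓ₁ ℓ₂} → fstℕ c ≡ fstℕ c′ → sndℕ c ≡ sndℕ c′ → c ≡ c′
cell-≡ a≡ b≡ = cong₂ _,_ (toℕ-injective a≡) (toℕ-injective b≡)

cell : ∀ {ℓ₁ ℓ₂ a b} → a < ℓ₁ → b < ℓ₂ → 𝓜 ℓ₁ ℓ₂
cell a<ℓ₁ b<ℓ₂ = fromℕ< a<ℓ₁ , fromℕ< b<ℓ₂

fstℕ-cell : ∀ {ℓ₁ ℓ₂ a b} (a<ℓ₁ : a < ℓ₁) (b<ℓ₂ : b < ℓ₂) → fstℕ (cell a<ℓ₁ b<ℓ₂) ≡ a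
fstℕ-cell a<ℓ₁ _ = toℕ-fromℕ< a<ℓ₁

sndℕ-cell : ∀ {ℓ₁ ℓ₂ a b} (a<ℓ₁ : a < ℓ₁) (b<ℓ₂ : b < ℓ₂) → sndℕ (cell a<ℓ₁ b<ℓ₂) ≡ b
sndℕ-cell _ b<ℓ₂ = toℕ-fromℕ< b<ℓ₂

cell-≼ : ∀ {ℓ₁ ℓ₂ a b} (a<ℓ₁ : a < ℓ₁) (b<ℓ₂ : b < ℓ₂) {c : 𝓜 ℓ₁ ℓ₂} →
         a ≤ fstℕ c → b ≤ sndℕ c → cell a<ℓ₁ b<ℓ₂ ≼ c
cell-≼ a<ℓ₁ b<ℓ₂ {c} a≤ b≤ =
  subst (_≤ fstℕ c) (sym (fstℕ-cell a<ℓ₁ b<ℓ₂)) a≤ , subst (_≤ sndℕ c) (sym (sndℕ-cell a<ℓ₁ b<ℓ₂)) b≤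

𝟙-×-dec : {P Q : Set} (d : Dec P) (e : Dec Q) → 𝟙 (d ×-dec e) ≡ 𝟙 d * 𝟙 e
𝟙-×-dec (yes _) (yes _) = refl
𝟙-×-dec (yes _) (no _)  = refl
𝟙-×-dec (no _)  _       = refl

discrete-ivt : (x : ℕ → ℕ) → (∀ i → x (suc i) ≤ suc (x i)) →
               ∀ {s t w} → s ≤ t → x s ≤ w → w ≤ x t → ∃ λ i → s ≤ i × i ≤ t × x i ≡ w
discrete-ivt x step {s} {t} {w} s≤t xs≤w w≤xt with x t ≟ w
... | yes xt≡w = t , s≤t , ≤-refl , xt≡w
... | no xt≢w with m≤n⇒m<n∨m≡n s≤t
...   | inj₂ refl = contradiction (≤-antisym w≤xt xs≤w) (xt≢w ∘ sym)
...   | inj₁ (s≤s {n = t′} s≤t′)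
        with discrete-ivt x step s≤t′ xs≤w (s≤s⁻¹ (<-≤-trans (≤∧≢⇒< w≤xt (xt≢w ∘ sym)) (step t′)))
...     | i , s≤i , i≤t′ , xi≡w = i , s≤i , m≤n⇒m≤1+n i≤t′ , xi≡w

module Grid (ℓ₁ ℓ₂ : ℕ) where

  open RankCounts (rank {ℓ₁} {ℓ₂}) public

  _∋⟨_,_⟩ : List (𝓜 ℓ₁ ℓ₂) → ℕ → ℕ → Set
  T ∋⟨ a , b ⟩ = Any (λ c → fstℕ c ≡ a × sndℕ c ≡ b) T

  at⟨_,_⟩? : ∀ a b (c : 𝓜 ℓ₁ ℓ₂) → Dec (fstℕ c ≡ a × sndℕ c ≡ b)
  at⟨ a , b ⟩? c = (fstℕ c ≟ a) ×-dec (sndℕ c ≟ b)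

  _∋?⟨_,_⟩ : ∀ T a b → Dec (T ∋⟨ a , b ⟩)
  T ∋?⟨ a , b ⟩ = any? at⟨ a , b ⟩? T

  gridSum : (ℕ → ℕ → ℕ) → ℕ
  gridSum f = Σ< ℓ₂ (λ b → Σ< ℓ₁ (λ a → f a b))

  cellSum : (ℕ → ℕ → ℕ) → List (𝓜 ℓ₁ ℓ₂) → ℕ
  cellSum f []       = 0
  cellSum f (c ∷ cs) = f (fstℕ c) (sndℕ c) + cellSum f cs

  gridSum-cong : ∀ {f g : ℕ → ℕ → ℕ} → (∀ a b → f a b ≡ g a b) → gridSum f ≡ gridSum g
  gridSum-cong f≡g = Σ<-cong ℓ₂ λ b _ → Σ<-cong ℓ₁ λ a _ → f≡g a b

  gridSum-distrib-+ : ∀ (f g : ℕ → ℕ → ℕ) → gridSum (λ a b → f a b + g a b) ≡ gridSum f + gridSum g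
  gridSum-distrib-+ f g = trans (Σ<-cong ℓ₂ λ b _ → Σ<-distrib-+ ℓ₁ (λ a → f a b) (λ a → g a b)) (Σ<-distrib-+ ℓ₂ _ _)

  gridSum-point : ∀ (c : 𝓜 ℓ₁ ℓ₂) (f : ℕ → ℕ → ℕ) →
                  gridSum (λ a b → 𝟙 (at⟨ a , b ⟩? c) * f a b) ≡ f (fstℕ c) (sndℕ c)
  gridSum-point c f = begin
    gridSum (λ a b → 𝟙 (at⟨ a , b ⟩? c) * f a b)
      ≡⟨ gridSum-cong reorder ⟩
    Σ< ℓ₂ (λ b → Σ< ℓ₁ (λ a → 𝟙 (sndℕ c ≟ b) * (𝟙 (fstℕ c ≟ a) * f a b)))
      ≡⟨ Σ<-cong ℓ₂ (λ b _ → Σ<-*-distribˡ ℓ₁ (𝟙 (sndℕ c ≟ b)) _) ⟨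
    Σ< ℓ₂ (λ b → 𝟙 (sndℕ c ≟ b) * Σ< ℓ₁ (λ a → 𝟙 (fstℕ c ≟ a) * f a b))
      ≡⟨ Σ<-cong ℓ₂ (λ b _ → cong (𝟙 (sndℕ c ≟ b) *_) (Σ<-point ℓ₁ (λ a → f a b) (toℕ<n (proj₁ c)))) ⟩
    Σ< ℓ₂ (λ b → 𝟙 (sndℕ c ≟ b) * f (fstℕ c) b)
      ≡⟨ Σ<-point ℓ₂ (f (fstℕ c)) (toℕ<n (proj₂ c)) ⟩
    f (fstℕ c) (sndℕ c) ∎
    where
    open ≡-Reasoning
    reorder : ∀ a b → 𝟙 (at⟨ a , b ⟩? c) * f a b ≡ 𝟙 (sndℕ c ≟ b) * (𝟙 (fstℕ c ≟ a) * f a b)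
    reorder a b = begin
      𝟙 (at⟨ a , b ⟩? c) * f a b      ≡⟨ cong (_* f a b) (𝟙-×-dec (fstℕ c ≟ a) (sndℕ c ≟ b)) ⟩
      𝟙 A * 𝟙 B * f a b               ≡⟨ cong (_* f a b) (*-comm (𝟙 A) (𝟙 B)) ⟩
      𝟙 B * 𝟙 A * f a b               ≡⟨ *-assoc (𝟙 B) (𝟙 A) (f a b) ⟩
      𝟙 B * (𝟙 A * f a b)             ∎
      where
      A = fstℕ c ≟ a
      B = sndℕ c ≟ b

  cellSum≡gridSum : ∀ (f : ℕ → ℕ → ℕ) T → Unique T → cellSum f T ≡ gridSum (λ a b → 𝟙 (T ∋?⟨ a , b ⟩) * f a b)
  cellSum≡gridSum f []      _          = sym (Σ<-zero ℓ₂ λ b _ → Σ<-zero ℓ₁ λ a _ → refl)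
  cellSum≡gridSum f (t ∷ T) (t∉T ∷ T!) = begin
    f (fstℕ t) (sndℕ t) + cellSum f T
      ≡⟨ cong₂ _+_ (gridSum-point t f) (sym (cellSum≡gridSum f T T!)) ⟨
    gridSum (λ a b → 𝟙 (at⟨ a , b ⟩? t) * f a b) + gridSum (λ a b → 𝟙 (T ∋?⟨ a , b ⟩) * f a b)
      ≡⟨ gridSum-distrib-+ _ _ ⟨
    gridSum (λ a b → 𝟙 (at⟨ a , b ⟩? t) * f a b + 𝟙 (T ∋?⟨ a , b ⟩) * f a b)
      ≡⟨ gridSum-cong (λ a b → sym (trans (cong (_* f a b) (𝟙-∷ a b))
                                          (*-distribʳ-+ (f a b) (𝟙 (at⟨ a , b ⟩? t)) (𝟙 (T ∋?⟨ a , b ⟩))))) ⟩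
    gridSum (λ a b → 𝟙 ((t ∷ T) ∋?⟨ a , b ⟩) * f a b) ∎
    where
    open ≡-Reasoning
    𝟙-∷ : ∀ a b → 𝟙 ((t ∷ T) ∋?⟨ a , b ⟩) ≡ 𝟙 (at⟨ a , b ⟩? t) + 𝟙 (T ∋?⟨ a , b ⟩)
    𝟙-∷ a b with at⟨ a , b ⟩? t | T ∋?⟨ a , b ⟩
    ... | yes (refl , refl) | yes t∈T = ⊥-elim (t∉T′ t∈T)
      where
      t∉T′ : ¬ T ∋⟨ fstℕ t , sndℕ t ⟩
      t∉T′ t∈T with find t∈T
      ... | t′ , t′∈ , a≡ , b≡ = All.lookup t∉T t′∈ (cell-≡ (sym a≡) (sym b≡))
    ... | yes _  | no _  = refl
    ... | no _   | yes _ = refl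
    ... | no _   | no _  = refl

  height : List (𝓜 ℓ₁ ℓ₂) → ℕ → ℕ
  height T b = count< ℓ₁ (λ a → T ∋?⟨ a , b ⟩)

  length≡Σheight : ∀ T → Unique T → length T ≡ Σ< ℓ₂ (height T)
  length≡Σheight T T! = begin
    length T                                          ≡⟨ cellSum-1 T ⟨
    cellSum (λ _ _ → 1) T                             ≡⟨ cellSum≡gridSum (λ _ _ → 1) T T! ⟩
    gridSum (λ a b → 𝟙 (T ∋?⟨ a , b ⟩) * 1)           ≡⟨ gridSum-cong (λ a b → *-identityʳ _) ⟩
    Σ< ℓ₂ (height T)                                  ∎
    where
    open ≡-Reasoning
    cellSum-1 : ∀ T → cellSum (λ _ _ → 1) T ≡ length T
    cellSum-1 []      = refl
    cellSum-1 (t ∷ T) = cong suc (cellSum-1 T)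

  DownClosed : List (𝓜 ℓ₁ ℓ₂) → Set
  DownClosed T = ∀ x y → x ∈ T → y ≼ x → y ∈ T

  ∋-bounded : ∀ {T a b} → T ∋⟨ a , b ⟩ → a < ℓ₁ × b < ℓ₂
  ∋-bounded t with find t
  ... | c , _ , refl , refl = toℕ<n (proj₁ c) , toℕ<n (proj₂ c)

  ∋-down : ∀ {T : List (𝓜 ℓ₁ ℓ₂)} → DownClosed T →
           ∀ {a b a′ b′} → T ∋⟨ a , b ⟩ → a′ ≤ a → b′ ≤ b → T ∋⟨ a′ , b′ ⟩
  ∋-down {T} closed {a′ = a′} {b′} t a′≤a b′≤b with find t
  ... | c , c∈T , refl , refl =
    lose (closed c _ c∈T (cell-≼ a′<ℓ₁ b′<ℓ₂ a′≤a b′≤b)) (fstℕ-cell a′<ℓ₁ b′<ℓ₂ , sndℕ-cell a′<ℓ₁ b′<ℓ₂)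
    where
    a′<ℓ₁ = ≤-<-trans a′≤a (toℕ<n (proj₁ c))
    b′<ℓ₂ = ≤-<-trans b′≤b (toℕ<n (proj₂ c))

  ∋⇔<height : ∀ {T : List (𝓜 ℓ₁ ℓ₂)} → DownClosed T → ∀ a b → T ∋⟨ a , b ⟩ ⇔ a < height T b
  ∋⇔<height closed a b = P⇔<count< (λ a → _ ∋?⟨ a , b ⟩) ℓ₁ (λ _ _ t a′≤a → ∋-down closed t a′≤a ≤-refl)
                                   (λ _ t → proj₁ (∋-bounded t)) a

  height-antitone : ∀ {T : List (𝓜 ℓ₁ ℓ₂)} → DownClosed T → ∀ {b b′} → b ≤ b′ → height T b′ ≤ height T b
  height-antitone {T} closed {b} {b′} b≤b′ = Σ<-mono-≤ ℓ₁ λ a _ → pointwise (T ∋?⟨ a , b′ ⟩)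
    where
    pointwise : ∀ {a} → Dec (T ∋⟨ a , b′ ⟩) → 𝟙 (T ∋?⟨ a , b′ ⟩) ≤ 𝟙 (T ∋?⟨ a , b ⟩)
    pointwise {a} (yes t) =
      ≤-trans (𝟙≤1 (T ∋?⟨ a , b′ ⟩)) (≤-reflexive (sym (𝟙-yes (T ∋?⟨ a , b ⟩) (∋-down closed t ≤-refl b≤b′))))
    pointwise {a} (no ¬t) = subst (_≤ _) (sym (𝟙-no (T ∋?⟨ a , b′ ⟩) ¬t)) z≤n

  length-total : ∀ {O : List (𝓜 ℓ₁ ℓ₂)} → IsTotalOrder O → length O ≡ ℓ₁ * ℓ₂
  length-total {O} (O! , all∈) = begin
    length O           ≡⟨ length≡Σheight O O! ⟩
    Σ< ℓ₂ (height O)   ≡⟨ Σ<-cong ℓ₂ (λ b b<ℓ₂ → count<-all _ ℓ₁ λ a a<ℓ₁ → full a<ℓ₁ b<ℓ₂) ⟩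
    Σ< ℓ₂ (λ _ → ℓ₁)   ≡⟨ Σ<-const ℓ₂ ℓ₁ ⟩
    ℓ₂ * ℓ₁            ≡⟨ *-comm ℓ₂ ℓ₁ ⟩
    ℓ₁ * ℓ₂            ∎
    where
    open ≡-Reasoning
    full : ∀ {a b} → a < ℓ₁ → b < ℓ₂ → O ∋⟨ a , b ⟩
    full a<ℓ₁ b<ℓ₂ = lose (all∈ (cell a<ℓ₁ b<ℓ₂)) (fstℕ-cell a<ℓ₁ b<ℓ₂ , sndℕ-cell a<ℓ₁ b<ℓ₂)

  private
    suc∸ : ∀ w j → suc w ∸ j ≡ 𝟙 (j ≤? w) + (w ∸ j)
    suc∸ w j with j ≤? w
    ... | yes j≤w = +-∸-assoc 1 j≤w
    ... | no j≰w = trans (m≤n⇒m∸n≡0 (≰⇒> j≰w)) (sym (m≤n⇒m∸n≡0 (<⇒≤ (≰⇒> j≰w))))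

    column-count : ∀ h b j → count< h (λ a → j ≤? a + b) + (b ∸ j) ≡ (b + h) ∸ j
    column-count zero    b j = cong (_∸ j) (sym (+-identityʳ b))
    column-count (suc h) b j = begin
      C + 𝟙 (j ≤? h + b) + (b ∸ j)        ≡⟨ +-assoc C _ _ ⟩
      C + (𝟙 (j ≤? h + b) + (b ∸ j))      ≡⟨ cong (C +_) (+-comm (𝟙 (j ≤? h + b)) (b ∸ j)) ⟩
      C + ((b ∸ j) + 𝟙 (j ≤? h + b))      ≡⟨ +-assoc C _ _ ⟨
      C + (b ∸ j) + 𝟙 (j ≤? h + b)        ≡⟨ cong (_+ 𝟙 (j ≤? h + b)) (column-count h b j) ⟩
      (b + h) ∸ j + 𝟙 (j ≤? h + b)        ≡⟨ +-comm ((b + h) ∸ j) _ ⟩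
      𝟙 (j ≤? h + b) + ((b + h) ∸ j)      ≡⟨ cong (λ w → 𝟙 (j ≤? w) + ((b + h) ∸ j)) (+-comm h b) ⟩
      𝟙 (j ≤? b + h) + ((b + h) ∸ j)      ≡⟨ suc∸ (b + h) j ⟨
      suc (b + h) ∸ j                     ≡⟨ cong (_∸ j) (+-suc b h) ⟨
      (b + suc h) ∸ j                     ∎
      where
      open ≡-Reasoning
      C = count< h (λ a → j ≤? a + b)

  #rank≥≡cellSum : ∀ j T → #rank≥ j T ≡ cellSum (λ a b → 𝟙 (j ≤? a + b)) T
  #rank≥≡cellSum j []      = refl
  #rank≥≡cellSum j (t ∷ T) = cong (𝟙 (j ≤? rank t) +_) (#rank≥≡cellSum j T)

  -- Column b of a downset is {(a , b) | a < height T b}, which has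
  -- (b + height T b) ∸ j - (b ∸ j) elements of rank at least j.
  #rank≥-by-columns : ∀ T → Unique T → DownClosed T → ∀ j →
                      #rank≥ j T + Σ< ℓ₂ (λ b → b ∸ j) ≡ Σ< ℓ₂ (λ b → (b + height T b) ∸ j)
  #rank≥-by-columns T T! closed j = begin
    #rank≥ j T + Σ< ℓ₂ (λ b → b ∸ j)
      ≡⟨ cong (_+ Σ< ℓ₂ (λ b → b ∸ j)) (trans (#rank≥≡cellSum j T) (cellSum≡gridSum _ T T!)) ⟩
    gridSum (λ a b → 𝟙 (T ∋?⟨ a , b ⟩) * 𝟙 (j ≤? a + b)) + Σ< ℓ₂ (λ b → b ∸ j)
      ≡⟨ Σ<-distrib-+ ℓ₂ _ _ ⟨
    Σ< ℓ₂ (λ b → Σ< ℓ₁ (λ a → 𝟙 (T ∋?⟨ a , b ⟩) * 𝟙 (j ≤? a + b)) + (b ∸ j))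
      ≡⟨ Σ<-cong ℓ₂ (λ b _ → column b) ⟩
    Σ< ℓ₂ (λ b → (b + height T b) ∸ j) ∎
    where
    open ≡-Reasoning
    column : ∀ b → Σ< ℓ₁ (λ a → 𝟙 (T ∋?⟨ a , b ⟩) * 𝟙 (j ≤? a + b)) + (b ∸ j) ≡ (b + height T b) ∸ j
    column b = begin
      Σ< ℓ₁ (λ a → 𝟙 (T ∋?⟨ a , b ⟩) * 𝟙 (j ≤? a + b)) + (b ∸ j)
        ≡⟨ cong (_+ (b ∸ j)) (Σ<-cong ℓ₁ λ a _ → cong (_* 𝟙 (j ≤? a + b))
                                                 (𝟙-cong (T ∋?⟨ a , b ⟩) (a <? height T b) (∋⇔<height closed a b))) ⟩
      Σ< ℓ₁ (λ a → 𝟙 (a <? height T b) * 𝟙 (j ≤? a + b)) + (b ∸ j)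
        ≡⟨ cong (_+ (b ∸ j)) (Σ<-initial ℓ₁ (λ a → 𝟙 (j ≤? a + b)) (count<≤ _ ℓ₁)) ⟩
      count< (height T b) (λ a → j ≤? a + b) + (b ∸ j)
        ≡⟨ column-count (height T b) b j ⟩
      (b + height T b) ∸ j ∎

  module _ (ℓ₁≤ℓ₂ : ℓ₁ ≤ ℓ₂) {T : List (𝓜 ℓ₁ ℓ₂)} (closed : DownClosed T) where
    open Majorization ℓ₂ using (Gapless)

    private
      x : ℕ → ℕ
      x b = b + height T b

      ivt : ∀ {s t w} → s ≤ t → x s ≤ w → w ≤ x t → ∃ λ i → s ≤ i × i ≤ t × x i ≡ w
      ivt = discrete-ivt x λ i → s≤s (+-monoʳ-≤ i (height-antitone closed (n≤1+n i)))

      inside : ∀ {s t w} → (∃ λ i → s ≤ i × i ≤ t × x i ≡ w) → t < ℓ₂ → ∃ λ b → b < ℓ₂ × x b ≡ w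
      inside (i , _ , i≤t , xi≡w) t<ℓ₂ = i , ≤-<-trans i≤t t<ℓ₂ , xi≡w

    -- x rises by at most one per step, reaches ℓ₂ - 1 at the last column and starts at
    -- height T 0 ≤ ℓ₁ ≤ ℓ₂, so it misses no value lying between two of its values.
    height-gapless : Gapless (λ b → b + height T b)
    height-gapless {w} {b₁} {b₂} b₁<ℓ₂ b₂<ℓ₂ x₁≤w w≤x₂ with b₁ ≤? b₂ | w <? ℓ₂
    ... | yes b₁≤b₂ | _        = inside (ivt b₁≤b₂ x₁≤w w≤x₂) b₂<ℓ₂
    ... | no _      | yes w<ℓ₂ = inside (ivt (<⇒≤pred b₁<ℓ₂) x₁≤w (≤-trans (<⇒≤pred w<ℓ₂) (m≤m+n (pred ℓ₂) _)))
                                        (pred<n b₁<ℓ₂)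
      where
      pred<n : ∀ {b n} → b < n → pred n < n
      pred<n (s≤s _) = ≤-refl
    ... | no _      | no w≮ℓ₂  = inside (ivt z≤n (≤-trans (count<≤ _ ℓ₁) (≤-trans ℓ₁≤ℓ₂ (≮⇒≥ w≮ℓ₂))) w≤x₂) b₂<ℓ₂

module _ {A : Set} where

  at : A → List A → ℕ → A
  at d []       _       = d
  at d (x ∷ xs) zero    = x
  at d (x ∷ xs) (suc i) = at d xs i

  at∈take : ∀ d xs {m i} → i < m → i < length xs → at d xs i ∈ take m xs
  at∈take d (x ∷ xs) {suc m} {zero}  _         _         = here refl
  at∈take d (x ∷ xs) {suc m} {suc i} (s≤s i<m) (s≤s i<n) = there (at∈take d xs i<m i<n)

  at∈ : ∀ d xs {i} → i < length xs → at d xs i ∈ xs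
  at∈ d (x ∷ xs) {zero}  _         = here refl
  at∈ d (x ∷ xs) {suc i} (s≤s i<n) = there (at∈ d xs i<n)

  ∈take⇒at : ∀ d xs m {y} → y ∈ take m xs → ∃ λ q → q < m × q < length xs × at d xs q ≡ y
  ∈take⇒at d (x ∷ xs) (suc m) (here refl) = zero , s≤s z≤n , s≤s z≤n , refl
  ∈take⇒at d (x ∷ xs) (suc m) (there y∈)  with ∈take⇒at d xs m y∈
  ... | q , q<m , q<n , xq≡y = suc q , s≤s q<m , s≤s q<n , xq≡y

  ∈⇒at : ∀ d xs {y} → y ∈ xs → ∃ λ q → q < length xs × at d xs q ≡ y
  ∈⇒at d (x ∷ xs) (here refl) = zero , s≤s z≤n , refl
  ∈⇒at d (x ∷ xs) (there y∈)  with ∈⇒at d xs y∈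
  ... | q , q<n , xq≡y = suc q , s≤s q<n , xq≡y

  at-injective : ∀ d xs → Unique xs → ∀ {i j} → i < length xs → j < length xs → at d xs i ≡ at d xs j → i ≡ j
  at-injective d (x ∷ xs) _           {zero}  {zero}  _         _         _  = refl
  at-injective d (x ∷ xs) (x∉ ∷ _)    {zero}  {suc j} _         (s≤s j<n) eq = ⊥-elim (All.lookup x∉ (at∈ d xs j<n) eq)
  at-injective d (x ∷ xs) (x∉ ∷ _)    {suc i} {zero}  (s≤s i<n) _         eq = ⊥-elim (All.lookup x∉ (at∈ d xs i<n) (sym eq))
  at-injective d (x ∷ xs) (_ ∷ xs!)   {suc i} {suc j} (s≤s i<n) (s≤s j<n) eq = cong suc (at-injective d xs xs! i<n j<n eq)

  take-suc-at : ∀ d xs {i} → i < length xs → take (suc i) xs ≡ take i xs ++ [ at d xs i ]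
  take-suc-at d (x ∷ xs) {zero}  _         = refl
  take-suc-at d (x ∷ xs) {suc i} (s≤s i<n) = cong (x ∷_) (take-suc-at d xs i<n)

  at-ext : ∀ d (xs ys : List A) → length xs ≡ length ys → (∀ i → i < length xs → at d xs i ≡ at d ys i) → xs ≡ ys
  at-ext d []       []       _   _  = refl
  at-ext d (x ∷ xs) (y ∷ ys) |≡| eq =
    cong₂ _∷_ (eq zero (s≤s z≤n)) (at-ext d xs ys (suc-injective |≡|) λ i i<n → eq (suc i) (s≤s i<n))

  at-lookup : ∀ d (xs : List A) (i : Fin (length xs)) → lookup xs i ≡ at d xs (toℕ i)
  at-lookup d (x ∷ xs) zero    = refl
  at-lookup d (x ∷ xs) (suc i) = at-lookup d xs i

  length-take≤ : ∀ {m} (xs : List A) → m ≤ length xs → length (take m xs) ≡ m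
  length-take≤ {m} xs m≤n = trans (length-take m xs) (m≤n⇒m⊓n≡m m≤n)

at-map : ∀ {A B : Set} (f : A → B) d xs i → at (f d) (map f xs) i ≡ f (at d xs i)
at-map f d []       i       = refl
at-map f d (x ∷ xs) zero    = refl
at-map f d (x ∷ xs) (suc i) = at-map f d xs i

at-applyUpTo : ∀ {A : Set} (f : ℕ → A) d {n i} → i < n → at d (applyUpTo f n) i ≡ f i
at-applyUpTo f d {suc n} {zero}  _         = refl
at-applyUpTo f d {suc n} {suc i} (s≤s i<n) = at-applyUpTo (f ∘ suc) d i<n

tabulate-toℕ : ∀ {A : Set} n (h : ℕ → A) → tabulate {n = n} (h ∘ toℕ) ≡ applyUpTo h n
tabulate-toℕ zero    h = refl
tabulate-toℕ (suc n) h = cong (h 0 ∷_) (tabulate-toℕ n (h ∘ suc))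

map-toℕ-allFin : ∀ {A : Set} n (h : ℕ → A) → map (h ∘ toℕ) (allFin n) ≡ applyUpTo h n
map-toℕ-allFin n h = trans (map-tabulate (λ i → i) (h ∘ toℕ)) (tabulate-toℕ n h)

applyUpTo-+ : ∀ {A : Set} (f : ℕ → A) m n → applyUpTo f (m + n) ≡ applyUpTo f m ++ applyUpTo (f ∘ (m +_)) n
applyUpTo-+ f zero    n = refl
applyUpTo-+ f (suc m) n = cong (f 0 ∷_) (applyUpTo-+ (f ∘ suc) m n)

*+<* : ∀ n {a a′ b} → a < a′ → b < n → a * n + b < a′ * n
*+<* n {a} {a′} {b} a<a′ b<n = begin-strict
  a * n + b     <⟨ +-monoʳ-< (a * n) b<n ⟩
  a * n + n     ≡⟨ +-comm (a * n) n ⟩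
  suc a * n     ≤⟨ *-monoˡ-≤ n a<a′ ⟩
  a′ * n        ∎
  where open ≤-Reasoning

*+≤*+⇒≤ : ∀ n {a b a′ b′} → a * n + b ≤ a′ * n + b′ → b′ < n → a ≤ a′
*+≤*+⇒≤ n {a} {b} {a′} {b′} le b′<n = ≮⇒≥ λ a′<a → <⇒≱ (<-≤-trans (*+<* n a′<a b′<n) (m≤m+n (a * n) b)) le

*+≡*+⇒≡ : ∀ n {a b a′ b′} → a * n + b ≡ a′ * n + b′ → b < n → b′ < n → a ≡ a′ × b ≡ b′
*+≡*+⇒≡ n {a} {b} {a′} {b′} eq b<n b′<n = a≡a′ , +-cancelˡ-≡ (a * n) b b′ (trans eq (cong (λ a → a * n + b′) (sym a≡a′)))
  where a≡a′ = ≤-antisym (*+≤*+⇒≤ n (≤-reflexive eq) b′<n) (*+≤*+⇒≤ n (≤-reflexive (sym eq)) b<n)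

module Lex (ℓ₁ ℓ₂ : ℕ) where

  open Grid ℓ₁ ℓ₂ using (DownClosed; _∋⟨_,_⟩)

  lexIndex : 𝓜 ℓ₁ ℓ₂ → ℕ
  lexIndex c = fstℕ c * ℓ₂ + sndℕ c

  lexIndex-injective : ∀ {c c′} → lexIndex c ≡ lexIndex c′ → c ≡ c′
  lexIndex-injective {c} {c′} eq with *+≡*+⇒≡ ℓ₂ eq (toℕ<n (proj₂ c)) (toℕ<n (proj₂ c′))
  ... | a≡ , b≡ = cell-≡ a≡ b≡

  lexIndex< : ∀ c → lexIndex c < ℓ₁ * ℓ₂
  lexIndex< c = ≤-trans (*+<* ℓ₂ (toℕ<n (proj₁ c)) (toℕ<n (proj₂ c))) ≤-refl

  lexIndex-cell : ∀ {a b} (a<ℓ₁ : a < ℓ₁) (b<ℓ₂ : b < ℓ₂) → lexIndex (cell a<ℓ₁ b<ℓ₂) ≡ a * ℓ₂ + b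
  lexIndex-cell a<ℓ₁ b<ℓ₂ = cong₂ (λ a b → a * ℓ₂ + b) (fstℕ-cell a<ℓ₁ b<ℓ₂) (sndℕ-cell a<ℓ₁ b<ℓ₂)

  map-lexIndex-𝓛 : map lexIndex (𝓛 ℓ₁ ℓ₂) ≡ upTo (ℓ₁ * ℓ₂)
  map-lexIndex-𝓛 = begin
    map lexIndex (𝓛 ℓ₁ ℓ₂)
      ≡⟨ map-concatMap lexIndex (λ a → map (a ,_) (allFin ℓ₂)) (allFin ℓ₁) ⟩
    concatMap (λ a → map lexIndex (map (a ,_) (allFin ℓ₂))) (allFin ℓ₁)
      ≡⟨ concatMap-cong (λ a → trans (sym (map-∘ (allFin ℓ₂))) (map-toℕ-allFin ℓ₂ (λ b → toℕ a * ℓ₂ + b))) (allFin ℓ₁) ⟩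
    concatMap (λ a → row (toℕ a)) (allFin ℓ₁)
      ≡⟨ concatMap-map row toℕ (allFin ℓ₁) ⟨
    concatMap row (map toℕ (allFin ℓ₁))
      ≡⟨ cong (concatMap row) (map-toℕ-allFin ℓ₁ (λ a → a)) ⟩
    concatMap row (upTo ℓ₁)
      ≡⟨ rows ℓ₁ ⟩
    upTo (ℓ₁ * ℓ₂) ∎
    where
    open ≡-Reasoning
    row : ℕ → List ℕ
    row a = applyUpTo (λ b → a * ℓ₂ + b) ℓ₂
    rows : ∀ n → concatMap row (upTo n) ≡ upTo (n * ℓ₂)
    rows zero    = refl
    rows (suc n) = begin
      concatMap row (upTo (suc n))          ≡⟨ cong (concatMap row) (upTo-∷ʳ n) ⟨
      concatMap row (upTo n ++ [ n ])       ≡⟨ concatMap-++ row (upTo n) [ n ] ⟩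
      concatMap row (upTo n) ++ (row n ++ []) ≡⟨ cong₂ _++_ (rows n) (++-identityʳ (row n)) ⟩
      upTo (n * ℓ₂) ++ row n                ≡⟨ applyUpTo-+ (λ i → i) (n * ℓ₂) ℓ₂ ⟨
      upTo (n * ℓ₂ + ℓ₂)                    ≡⟨ cong upTo (+-comm (n * ℓ₂) ℓ₂) ⟩
      upTo (suc n * ℓ₂)                     ∎

  length-𝓛 : length (𝓛 ℓ₁ ℓ₂) ≡ ℓ₁ * ℓ₂
  length-𝓛 = trans (sym (length-map lexIndex (𝓛 ℓ₁ ℓ₂))) (trans (cong length map-lexIndex-𝓛) (length-upTo (ℓ₁ * ℓ₂)))

  𝓛-unique : Unique (𝓛 ℓ₁ ℓ₂)
  𝓛-unique = Unique.map⁻ (subst Unique (sym map-lexIndex-𝓛) (Unique.upTo⁺ (ℓ₁ * ℓ₂)))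

  lexIndex-at : ∀ d {i} → i < ℓ₁ * ℓ₂ → lexIndex (at d (𝓛 ℓ₁ ℓ₂) i) ≡ i
  lexIndex-at d {i} i<N = begin
    lexIndex (at d (𝓛 ℓ₁ ℓ₂) i)                 ≡⟨ at-map lexIndex d (𝓛 ℓ₁ ℓ₂) i ⟨
    at (lexIndex d) (map lexIndex (𝓛 ℓ₁ ℓ₂)) i  ≡⟨ cong (λ xs → at (lexIndex d) xs i) map-lexIndex-𝓛 ⟩
    at (lexIndex d) (upTo (ℓ₁ * ℓ₂)) i          ≡⟨ at-applyUpTo (λ j → j) (lexIndex d) i<N ⟩
    i                                           ∎
    where open ≡-Reasoning

  at-lexIndex : ∀ d c → at d (𝓛 ℓ₁ ℓ₂) (lexIndex c) ≡ c
  at-lexIndex d c = lexIndex-injective (lexIndex-at d (lexIndex< c))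

  lexIndex<length : ∀ c → lexIndex c < length (𝓛 ℓ₁ ℓ₂)
  lexIndex<length c = subst (lexIndex c <_) (sym length-𝓛) (lexIndex< c)

  ∈𝓛 : ∀ c → c ∈ 𝓛 ℓ₁ ℓ₂
  ∈𝓛 c = subst (_∈ 𝓛 ℓ₁ ℓ₂) (at-lexIndex c c) (at∈ c (𝓛 ℓ₁ ℓ₂) (lexIndex<length c))

  ∈take-𝓛⇔ : ∀ m c → c ∈ take m (𝓛 ℓ₁ ℓ₂) ⇔ lexIndex c < m
  ∈take-𝓛⇔ m c = mk⇔ to (λ c<m → subst (_∈ take m (𝓛 ℓ₁ ℓ₂)) (at-lexIndex c c) (at∈take c (𝓛 ℓ₁ ℓ₂) c<m (lexIndex<length c)))
    where
    to : c ∈ take m (𝓛 ℓ₁ ℓ₂) → lexIndex c < m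
    to c∈ with ∈take⇒at c (𝓛 ℓ₁ ℓ₂) m c∈
    ... | q , q<m , q<n , at≡c = subst (_< m) (trans (sym (lexIndex-at c (subst (q <_) length-𝓛 q<n))) (cong lexIndex at≡c)) q<m

  take-𝓛-closed : ∀ m → DownClosed (take m (𝓛 ℓ₁ ℓ₂))
  take-𝓛-closed m x y x∈ (a≤ , b≤) =
    Equivalence.from (∈take-𝓛⇔ m y) (≤-<-trans (+-mono-≤ (*-monoˡ-≤ ℓ₂ a≤) b≤) (Equivalence.to (∈take-𝓛⇔ m x) x∈))

  take-𝓛∋⇔ : ∀ m {a b} → a < ℓ₁ → b < ℓ₂ → take m (𝓛 ℓ₁ ℓ₂) ∋⟨ a , b ⟩ ⇔ a * ℓ₂ + b < m
  take-𝓛∋⇔ m {a} {b} a<ℓ₁ b<ℓ₂ = mk⇔ to from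
    where
    to : take m (𝓛 ℓ₁ ℓ₂) ∋⟨ a , b ⟩ → a * ℓ₂ + b < m
    to t with find t
    ... | c , c∈ , refl , refl = Equivalence.to (∈take-𝓛⇔ m c) c∈
    from : a * ℓ₂ + b < m → take m (𝓛 ℓ₁ ℓ₂) ∋⟨ a , b ⟩
    from ab<m = lose (Equivalence.from (∈take-𝓛⇔ m (cell a<ℓ₁ b<ℓ₂)) (subst (_< m) (sym (lexIndex-cell a<ℓ₁ b<ℓ₂)) ab<m))
                     (fstℕ-cell a<ℓ₁ b<ℓ₂ , sndℕ-cell a<ℓ₁ b<ℓ₂)

rank-≤⇒wt-≤ : ∀ {ℓ₁ ℓ₂} {wt : Weight ℓ₁ ℓ₂} → RankIncreasing wt → RankConstant wt →
              ∀ {x y} → rank x ≤ rank y → wt x ℚ.≤ wt y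
rank-≤⇒wt-≤ increasing constant {x} {y} x≤y with m≤n⇒m<n∨m≡n x≤y
... | inj₁ x<y = ℚ.<⇒≤ (increasing x y x<y)
... | inj₂ x≡y = ℚ.≤-reflexive (constant x y x≡y)

module Optimality (ℓ₁ ℓ₂ : ℕ) (ℓ₁≤ℓ₂ : ℓ₁ ≤ ℓ₂) where

  open Grid ℓ₁ ℓ₂
  open Lex ℓ₁ ℓ₂
  open Majorization ℓ₂ using (excess-≤; no-crossing; NearlyArithmetic)

  private
    prefix : ℕ → List (𝓜 ℓ₁ ℓ₂)
    prefix m = take m (𝓛 ℓ₁ ℓ₂)

    length-prefix : ∀ {m} → m ≤ ℓ₁ * ℓ₂ → length (prefix m) ≡ m
    length-prefix m≤N = length-take≤ (𝓛 ℓ₁ ℓ₂) (subst (_ ≤_) (sym length-𝓛) m≤N)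

  -- If column 0 were two cells taller than the last column, of height h, the last cell
  -- (h , ℓ₂ - 1) of row h would precede the cell (h + 1 , 0) of the prefix in 𝓛.
  prefix-height-balanced : ∀ m → height (prefix m) 0 ≤ suc (height (prefix m) (pred ℓ₂))
  prefix-height-balanced m = ≮⇒≥ λ h+1<h₀ → n≮n h (Equivalence.to (∋⇔<height closed h (pred ℓ₂)) (corner∈ h+1<h₀))
    where
    closed = take-𝓛-closed m
    h = height (prefix m) (pred ℓ₂)
    corner∈ : suc h < height (prefix m) 0 → prefix m ∋⟨ h , pred ℓ₂ ⟩
    corner∈ h+1<h₀ with Equivalence.from (∋⇔<height closed (suc h) 0) h+1<h₀
    ... | first∈ with ∋-bounded first∈
    ...   | h+1<ℓ₁ , 0<ℓ₂@(s≤s _) = Equivalence.from (take-𝓛∋⇔ m (<⇒≤ h+1<ℓ₁) ≤-refl)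
      (<-trans (*+<* ℓ₂ {h} {suc h} ≤-refl ≤-refl)
               (subst (_< m) (+-identityʳ _) (Equivalence.to (take-𝓛∋⇔ m h+1<ℓ₁ 0<ℓ₂) first∈)))

  prefix-nearlyArithmetic : ∀ m → NearlyArithmetic (λ b → b + height (prefix m) b) (height (prefix m) (pred ℓ₂))
  prefix-nearlyArithmetic m b b<ℓ₂ =
      subst (_≤ b + height (prefix m) b) (+-comm b _) (+-monoʳ-≤ b (height-antitone closed (<⇒≤pred b<ℓ₂)))
    , ≤-trans (+-monoʳ-≤ b (≤-trans (height-antitone closed z≤n) (prefix-height-balanced m)))
              (≤-reflexive (trans (+-suc b _) (cong suc (+-comm b _))))
    where closed = take-𝓛-closed m

  prefix-dominates : ∀ {m T} → m ≤ ℓ₁ * ℓ₂ → IsDownset T → length T ≡ m → ∀ j → #rank≥ j T ≤ #rank≥ j (prefix m)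
  prefix-dominates {m} {T} m≤N (T! , closed) |T| j = +-cancelʳ-≤ (Σ< ℓ₂ (λ b → b ∸ j)) _ _ (begin
    #rank≥ j T + Σ< ℓ₂ (λ b → b ∸ j)           ≡⟨ #rank≥-by-columns T T! closed j ⟩
    Σ< ℓ₂ (λ b → x b ∸ j)                      ≤⟨ excess-≤ x y total≡ no-crossing′ j ⟩
    Σ< ℓ₂ (λ b → y b ∸ j)                      ≡⟨ #rank≥-by-columns (prefix m) prefix! (take-𝓛-closed m) j ⟨
    #rank≥ j (prefix m) + Σ< ℓ₂ (λ b → b ∸ j)  ∎)
    where
    open ≤-Reasoning
    prefix! = Unique.take⁺ m 𝓛-unique
    x y : ℕ → ℕ
    x b = b + height T b
    y b = b + height (prefix m) b
    no-crossing′ = no-crossing x y _ (height-gapless ℓ₁≤ℓ₂ closed) (prefix-nearlyArithmetic m)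
    Σ-column : ∀ U → Unique U → Σ< ℓ₂ (λ b → b + height U b) ≡ Σ< ℓ₂ (λ b → b) + length U
    Σ-column U U! = trans (Σ<-distrib-+ ℓ₂ (λ b → b) (height U)) (cong (Σ< ℓ₂ (λ b → b) +_) (sym (length≡Σheight U U!)))
    total≡ : Σ< ℓ₂ x ≡ Σ< ℓ₂ y
    total≡ = begin-equality
      Σ< ℓ₂ x                            ≡⟨ Σ-column T T! ⟩
      Σ< ℓ₂ (λ b → b) + length T         ≡⟨ cong (Σ< ℓ₂ (λ b → b) +_) (trans |T| (sym (length-prefix m≤N))) ⟩
      Σ< ℓ₂ (λ b → b) + length (prefix m) ≡⟨ Σ-column (prefix m) prefix! ⟨
      Σ< ℓ₂ y                            ∎

  𝓛-nested : ∀ (wt : Weight ℓ₁ ℓ₂) → RankIncreasing wt → RankConstant wt → GivesNestedSolutions wt (𝓛 ℓ₁ ℓ₂)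
  𝓛-nested wt increasing constant m m≤N = (Unique.take⁺ m 𝓛-unique , take-𝓛-closed m) , optimal
    where
    optimal : ∀ T → IsDownset T → length T ≡ length (prefix m) → wtSum wt T ℚ.≤ wtSum wt (prefix m)
    optimal T T-down |T| = wsum-≤ wt (rank-≤⇒wt-≤ increasing constant) m T (prefix m) |T|′ (length-prefix m≤N)
                                  (prefix-dominates m≤N T-down |T|′)
      where |T|′ = trans |T| (length-prefix m≤N)

module Rigidity (ℓ₁ ℓ₂ : ℕ) (ℓ₁≤ℓ₂ : ℓ₁ ≤ ℓ₂) (o : ℕ → 𝓜 ℓ₁ ℓ₂)
  (o-injective  : ∀ {i j} → i < ℓ₁ * ℓ₂ → j < ℓ₁ * ℓ₂ → o i ≡ o j → i ≡ j)
  (o-surjective : ∀ c → ∃ λ q → q < ℓ₁ * ℓ₂ × o q ≡ c)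
  (o-closed     : ∀ {p c} → p < ℓ₁ * ℓ₂ → c ≼ o p → ∃ λ q → q ≤ p × o q ≡ c)
  (o-rank       : ∀ c → rank (o (Lex.lexIndex ℓ₁ ℓ₂ c)) ≡ rank c)
  where

  open Lex ℓ₁ ℓ₂

  position-≤ : ∀ {p q} → p < ℓ₁ * ℓ₂ → q < ℓ₁ * ℓ₂ → o q ≼ o p → q ≤ p
  position-≤ {p} p<N q<N oq≼op with o-closed p<N oq≼op
  ... | q′ , q′≤p , oq′≡oq = subst (_≤ p) (o-injective (≤-<-trans q′≤p p<N) q<N oq′≡oq) q′≤p

  module _ {i} (i<N : i < ℓ₁ * ℓ₂) (ih : ∀ {i′} → i′ < i → lexIndex (o i′) ≡ i′) where

    late : ∀ {p} → p < ℓ₁ * ℓ₂ → i ≤ p → i ≤ lexIndex (o p)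
    late {p} p<N i≤p = ≮⇒≥ λ lt →
      <-irrefl (o-injective (lexIndex< (o p)) p<N (lexIndex-injective (ih lt))) (<-≤-trans lt i≤p)

    earlier : ∀ {a b} → a ≤ fstℕ (o i) → b ≤ sndℕ (o i) → a < fstℕ (o i) ⊎ b < sndℕ (o i) → a * ℓ₂ + b < i
    earlier {a} {b} a≤ b≤ strict = subst (_< i) (lexIndex-cell a<ℓ₁ b<ℓ₂) (precedes (o-closed i<N e≼oi))
      where
      a<ℓ₁ = ≤-<-trans a≤ (toℕ<n (proj₁ (o i)))
      b<ℓ₂ = ≤-<-trans b≤ (toℕ<n (proj₂ (o i)))
      e = cell a<ℓ₁ b<ℓ₂
      e≼oi = cell-≼ a<ℓ₁ b<ℓ₂ a≤ b≤
      e≢oi : e ≢ o i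
      e≢oi e≡oi = ⊎-elim (<-irrefl (trans (sym (fstℕ-cell a<ℓ₁ b<ℓ₂)) (cong fstℕ e≡oi)))
                         (<-irrefl (trans (sym (sndℕ-cell a<ℓ₁ b<ℓ₂)) (cong sndℕ e≡oi))) strict
      precedes : (∃ λ q → q ≤ i × o q ≡ e) → lexIndex e < i
      precedes (q , q≤i , oq≡e) with m≤n⇒m<n∨m≡n q≤i
      ... | inj₁ q<i  = subst (_< i) (trans (sym (ih q<i)) (cong lexIndex oq≡e)) q<i
      ... | inj₂ refl = contradiction (sym oq≡e) e≢oi

    private
      c : 𝓜 ℓ₁ ℓ₂
      c = at (o 0) (𝓛 ℓ₁ ℓ₂) i
      a = fstℕ c
      b = sndℕ c

      i≡ab : i ≡ a * ℓ₂ + b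
      i≡ab = sym (lexIndex-at (o 0) i<N)

      rank-o-i : fstℕ (o i) + sndℕ (o i) ≡ a + b
      rank-o-i = trans (cong (λ j → rank (o j)) i≡ab) (o-rank c)

      beyond-row : ∀ {a′ b′} → a < a′ → ¬ (a′ * ℓ₂ + b′ < i)
      beyond-row {a′} {b′} a<a′ lt = <-asym lt (subst (_< a′ * ℓ₂ + b′) (sym i≡ab)
                                         (<-≤-trans (*+<* ℓ₂ a<a′ (toℕ<n (proj₂ c))) (m≤m+n _ _)))

    row-≤ : a ≤ fstℕ (o i)
    row-≤ = *+≤*+⇒≤ ℓ₂ (subst (_≤ lexIndex (o i)) i≡ab (late i<N ≤-refl)) (toℕ<n (proj₂ (o i)))

    same-row⇒placed : fstℕ (o i) ≡ a → lexIndex (o i) ≡ i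
    same-row⇒placed a′≡a = begin
      fstℕ (o i) * ℓ₂ + sndℕ (o i)  ≡⟨ cong₂ (λ x y → x * ℓ₂ + y) a′≡a b′≡b ⟩
      a * ℓ₂ + b                    ≡⟨ i≡ab ⟨
      i                             ∎
      where
      open ≡-Reasoning
      b′≡b = +-cancelˡ-≡ a _ _ (trans (cong (_+ sndℕ (o i)) (sym a′≡a)) rank-o-i)

    -- A later row can only be entered at its first cell, and only from the second cell of
    -- the current row: the cells just left of and just below o i must already be placed.
    displaced : a < fstℕ (o i) → fstℕ (o i) ≡ suc a × sndℕ (o i) ≡ 0 × b ≡ 1
    displaced a<a′ = a′≡ , b′≡0 , b≡1
      where
      a′≡ : fstℕ (o i) ≡ suc a
      a′≡ = ≤-antisym (≮⇒≥ λ a+1<a′ → beyond-row (n<1+n a) (earlier (<⇒≤ a+1<a′) ≤-refl (inj₁ a+1<a′))) a<a′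
      b′≡0 : sndℕ (o i) ≡ 0
      b′≡0 with sndℕ (o i) in b′≡
      ... | zero    = refl
      ... | suc b″ = ⊥-elim (beyond-row a<a′ (earlier ≤-refl (<⇒≤ b″<b′) (inj₂ b″<b′)))
        where b″<b′ = ≤-reflexive (sym b′≡)
      b≡1 : b ≡ 1
      b≡1 = sym (+-cancelˡ-≡ a 1 b (trans (+-suc a 0) (trans (sym (cong₂ _+_ a′≡ b′≡0)) rank-o-i)))

    module _ (a′≡ : fstℕ (o i) ≡ suc a) (b≡1 : b ≡ 1) where

      private
        a<ℓ₁ : a < ℓ₁
        a<ℓ₁ = toℕ<n (proj₁ c)
        1<ℓ₂ : 1 < ℓ₂
        1<ℓ₂ = subst (_< ℓ₂) b≡1 (toℕ<n (proj₂ c))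
        e = cell a<ℓ₁ 1<ℓ₂

        e-index : lexIndex e ≡ i
        e-index = trans (lexIndex-cell a<ℓ₁ 1<ℓ₂) (trans (cong (a * ℓ₂ +_) (sym b≡1)) (sym i≡ab))

      -- Position q has rank a + 1 in 𝓛 as well, and the only such position in row a is i ≠ q.
      second-cell-late : ∀ {q} → q < ℓ₁ * ℓ₂ → o q ≡ e → suc a * ℓ₂ ≤ q
      second-cell-late {q} q<N oq≡e = begin
        suc a * ℓ₂                ≤⟨ *-monoˡ-≤ ℓ₂ a<a″ ⟩
        a″ * ℓ₂                   ≤⟨ m≤m+n _ _ ⟩
        a″ * ℓ₂ + sndℕ cq         ≡⟨ lexIndex-at (o 0) q<N ⟩
        q                         ∎
        where
        open ≤-Reasoning
        cq = at (o 0) (𝓛 ℓ₁ ℓ₂) q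
        a″ = fstℕ cq
        q≡ : q ≡ a″ * ℓ₂ + sndℕ cq
        q≡ = sym (lexIndex-at (o 0) q<N)
        i≤q : i ≤ q
        i≤q = ≮⇒≥ λ q<i → <-irrefl (trans (sym (ih q<i)) (trans (cong lexIndex oq≡e) e-index)) q<i
        q≢i : q ≢ i
        q≢i refl = 1+n≢n (trans (sym a′≡) (trans (cong fstℕ oq≡e) (fstℕ-cell a<ℓ₁ 1<ℓ₂)))
        rank-cq : a″ + sndℕ cq ≡ a + 1
        rank-cq = trans (sym (o-rank cq)) (trans (cong (λ j → rank (o j)) (sym q≡))
                    (trans (cong rank oq≡e) (cong₂ _+_ (fstℕ-cell a<ℓ₁ 1<ℓ₂) (sndℕ-cell a<ℓ₁ 1<ℓ₂))))
        a<a″ : a < a″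
        a<a″ with m≤n⇒m<n∨m≡n (*+≤*+⇒≤ ℓ₂ (subst₂ _≤_ i≡ab q≡ i≤q) (toℕ<n (proj₂ cq)))
        ... | inj₁ a<a″ = a<a″
        ... | inj₂ a≡a″ = contradiction (begin-equality
          q                    ≡⟨ q≡ ⟩
          a″ * ℓ₂ + sndℕ cq    ≡⟨ cong₂ (λ x y → x * ℓ₂ + y) (sym a≡a″) (trans b″≡1 (sym b≡1)) ⟩
          a * ℓ₂ + b           ≡⟨ i≡ab ⟨
          i                    ∎) q≢i
          where b″≡1 = +-cancelˡ-≡ a _ 1 (trans (cong (_+ sndℕ cq) a≡a″) rank-cq)

      -- Since (a , 1) comes after the whole of row a, the 𝓛-position of the last cell of
      -- row a must hold a cell of column 0, namely (a + ℓ₂ - 1 , 0).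
      displaced⇒tall : a + ℓ₂ ≤ ℓ₁
      displaced⇒tall with o-surjective e
      ... | q , q<N , oq≡e = begin
        a + ℓ₂              ≡⟨ cong (a +_) (suc-pred-ℓ₂) ⟨
        a + suc (pred ℓ₂)   ≡⟨ +-suc a (pred ℓ₂) ⟩
        suc (a + pred ℓ₂)   ≡⟨ cong suc op-row ⟨
        suc (fstℕ (o p))    ≤⟨ toℕ<n (proj₁ (o p)) ⟩
        ℓ₁                  ∎
        where
        open ≤-Reasoning
        suc-pred-ℓ₂ : suc (pred ℓ₂) ≡ ℓ₂
        suc-pred-ℓ₂ with 1<ℓ₂
        ... | s≤s _ = refl
        pred<ℓ₂ : pred ℓ₂ < ℓ₂
        pred<ℓ₂ = ≤-reflexive suc-pred-ℓ₂
        cp = cell a<ℓ₁ pred<ℓ₂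
        p = lexIndex cp
        p<N = lexIndex< cp
        i≤p : i ≤ p
        i≤p = subst₂ _≤_ e-index (sym (lexIndex-cell a<ℓ₁ pred<ℓ₂))
                (subst (_≤ a * ℓ₂ + pred ℓ₂) (sym (lexIndex-cell a<ℓ₁ 1<ℓ₂)) (+-monoʳ-≤ (a * ℓ₂) (<⇒≤pred 1<ℓ₂)))
        p<q : p < q
        p<q = <-≤-trans (subst (_< suc a * ℓ₂) (sym (lexIndex-cell a<ℓ₁ pred<ℓ₂)) (*+<* ℓ₂ (n<1+n a) pred<ℓ₂))
                        (second-cell-late q<N oq≡e)
        a≤op : a ≤ fstℕ (o p)
        a≤op = *+≤*+⇒≤ ℓ₂ (subst (_≤ lexIndex (o p)) i≡ab (late p<N i≤p)) (toℕ<n (proj₂ (o p)))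
        op-column : sndℕ (o p) ≡ 0
        op-column with sndℕ (o p) in op-snd
        ... | zero  = refl
        ... | suc _ = ⊥-elim (<⇒≱ p<q (position-≤ p<N q<N (subst (_≼ o p) (sym oq≡e) e≼op)))
          where e≼op = cell-≼ a<ℓ₁ 1<ℓ₂ a≤op (subst (1 ≤_) (sym op-snd) (s≤s z≤n))
        op-row : fstℕ (o p) ≡ a + pred ℓ₂
        op-row = begin-equality
          fstℕ (o p)                  ≡⟨ +-identityʳ _ ⟨
          fstℕ (o p) + 0              ≡⟨ cong (fstℕ (o p) +_) op-column ⟨
          fstℕ (o p) + sndℕ (o p)     ≡⟨ o-rank cp ⟩
          fstℕ cp + sndℕ cp           ≡⟨ cong₂ _+_ (fstℕ-cell a<ℓ₁ pred<ℓ₂) (sndℕ-cell a<ℓ₁ pred<ℓ₂) ⟩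
          a + pred ℓ₂                 ∎

    step : ¬ (ℓ₁ ≡ ℓ₂ × fstℕ (o 1) ≡ 1 × sndℕ (o 1) ≡ 0) → lexIndex (o i) ≡ i
    step regular with m≤n⇒m<n∨m≡n row-≤
    ... | inj₂ a≡a′ = same-row⇒placed (sym a≡a′)
    ... | inj₁ a<a′ with displaced a<a′
    ...   | a′≡ , b′≡0 , b≡1 = ⊥-elim (regular (ℓ₁≡ℓ₂ , subst (λ j → fstℕ (o j) ≡ 1) i≡1 (trans a′≡ (cong suc a≡0))
                                                   , subst (λ j → sndℕ (o j) ≡ 0) i≡1 b′≡0))
      where
      tall = displaced⇒tall a′≡ b≡1
      a≡0 : a ≡ 0
      a≡0 = n≤0⇒n≡0 (+-cancelʳ-≤ ℓ₂ a 0 (≤-trans tall ℓ₁≤ℓ₂))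
      ℓ₁≡ℓ₂ : ℓ₁ ≡ ℓ₂
      ℓ₁≡ℓ₂ = ≤-antisym ℓ₁≤ℓ₂ (≤-trans (m≤n+m ℓ₂ a) tall)
      i≡1 : i ≡ 1
      i≡1 = trans i≡ab (cong₂ (λ x y → x * ℓ₂ + y) a≡0 b≡1)

  lexIndex-o : ¬ (ℓ₁ ≡ ℓ₂ × fstℕ (o 1) ≡ 1 × sndℕ (o 1) ≡ 0) → ∀ i → i < ℓ₁ * ℓ₂ → lexIndex (o i) ≡ i
  lexIndex-o regular = <-rec _ λ i rec i<N → step i<N (λ i′<i → rec i′<i (<-trans i′<i i<N)) regular

wt≡⇒rank≡ : ∀ {ℓ₁ ℓ₂} {wt : Weight ℓ₁ ℓ₂} → RankIncreasing wt → ∀ {x y} → wt x ≡ wt y → rank x ≡ rank y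
wt≡⇒rank≡ increasing {x} {y} eq with <-cmp (rank x) (rank y)
... | tri< x<y _ _ = ⊥-elim (ℚ.<-irrefl eq (increasing x y x<y))
... | tri≈ _ x≡y _ = x≡y
... | tri> _ _ y<x = ⊥-elim (ℚ.<-irrefl (sym eq) (increasing y x y<x))

wtSum-++ : ∀ {ℓ₁ ℓ₂} (wt : Weight ℓ₁ ℓ₂) xs ys → wtSum wt (xs ++ ys) ≡ wtSum wt xs ℚ.+ wtSum wt ys
wtSum-++ wt []       ys = sym (ℚ.+-identityˡ (wtSum wt ys))
wtSum-++ wt (x ∷ xs) ys = trans (cong (wt x ℚ.+_) (wtSum-++ wt xs ys)) (sym (ℚ.+-assoc (wt x) _ _))

module Uniqueness (ℓ₁ ℓ₂ : ℕ) (ℓ₁≤ℓ₂ : ℓ₁ ≤ ℓ₂) (d : 𝓜 ℓ₁ ℓ₂) {wt : Weight ℓ₁ ℓ₂}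
  (increasing : RankIncreasing wt) (constant : RankConstant wt)
  {O : List (𝓜 ℓ₁ ℓ₂)} (total : IsTotalOrder O) (nested : GivesNestedSolutions wt O)
  where

  open Grid ℓ₁ ℓ₂ using (length-total)
  open Lex ℓ₁ ℓ₂

  private
    o : ℕ → 𝓜 ℓ₁ ℓ₂
    o = at d O

    <length : ∀ {i} → i < ℓ₁ * ℓ₂ → i < length O
    <length {i} = subst (i <_) (sym (length-total total))

    o-closed : ∀ {p c} → p < ℓ₁ * ℓ₂ → c ≼ o p → ∃ λ q → q ≤ p × o q ≡ c
    o-closed {p} {c} p<N c≼op with ∈take⇒at d O (suc p) (proj₂ (proj₁ (nested (suc p) p<N)) (o p) c op∈ c≼op)
      where op∈ = at∈take d O ≤-refl (<length p<N)
    ... | q , q<1+p , _ , oq≡c = q , s≤s⁻¹ q<1+p , oq≡c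

    prefix-wt≡ : ∀ {p} → p ≤ ℓ₁ * ℓ₂ → wtSum wt (take p O) ≡ wtSum wt (take p (𝓛 ℓ₁ ℓ₂))
    prefix-wt≡ {p} p≤N = ℚ.≤-antisym
      (proj₂ 𝓛-prefix-optimal (take p O) (proj₁ O-prefix-optimal) (trans |O-prefix| (sym |𝓛-prefix|)))
      (proj₂ O-prefix-optimal (take p (𝓛 ℓ₁ ℓ₂)) (proj₁ 𝓛-prefix-optimal) (trans |𝓛-prefix| (sym |O-prefix|)))
      where
      O-prefix-optimal = nested p p≤N
      𝓛-prefix-optimal = Optimality.𝓛-nested ℓ₁ ℓ₂ ℓ₁≤ℓ₂ wt increasing constant p p≤N
      |O-prefix| = length-take≤ O (subst (p ≤_) (sym (length-total total)) p≤N)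
      |𝓛-prefix| = length-take≤ (𝓛 ℓ₁ ℓ₂) (subst (p ≤_) (sym length-𝓛) p≤N)

    wt≡ : ∀ {i} → i < ℓ₁ * ℓ₂ → wt (o i) ≡ wt (at d (𝓛 ℓ₁ ℓ₂) i)
    wt≡ {i} i<N = +-cancelˡ (wtSum wt (take i O)) _ _ (begin
      wtSum wt (take i O) ℚ.+ wt (o i)          ≡⟨ cong (wtSum wt (take i O) ℚ.+_) (ℚ.+-identityʳ (wt (o i))) ⟨
      wtSum wt (take i O) ℚ.+ wtSum wt [ o i ]  ≡⟨ wtSum-++ wt (take i O) [ o i ] ⟨
      wtSum wt (take i O ++ [ o i ])            ≡⟨ cong (wtSum wt) (take-suc-at d O (<length i<N)) ⟨
      wtSum wt (take (suc i) O)                 ≡⟨ prefix-wt≡ i<N ⟩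
      wtSum wt (take (suc i) L)                 ≡⟨ cong (wtSum wt) (take-suc-at d L (subst (i <_) (sym length-𝓛) i<N)) ⟩
      wtSum wt (take i L ++ [ c ])              ≡⟨ wtSum-++ wt (take i L) [ c ] ⟩
      wtSum wt (take i L) ℚ.+ wtSum wt [ c ]    ≡⟨ cong₂ ℚ._+_ (prefix-wt≡ (<⇒≤ i<N)) (sym (ℚ.+-identityʳ (wt c))) ⟨
      wtSum wt (take i O) ℚ.+ wt c              ∎)
      where
      open ≡-Reasoning
      L = 𝓛 ℓ₁ ℓ₂
      c = at d L i
      +-cancelˡ = Group.∙-cancelˡ ℚ.+-0-group

    o-rank : ∀ c → rank (o (lexIndex c)) ≡ rank c
    o-rank c = trans (wt≡⇒rank≡ increasing (wt≡ (lexIndex< c))) (cong rank (at-lexIndex d c))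

    o-injective : ∀ {i j} → i < ℓ₁ * ℓ₂ → j < ℓ₁ * ℓ₂ → o i ≡ o j → i ≡ j
    o-injective i<N j<N = at-injective d O (proj₁ total) (<length i<N) (<length j<N)

    o-surjective : ∀ c → ∃ λ q → q < ℓ₁ * ℓ₂ × o q ≡ c
    o-surjective c with ∈⇒at d O (proj₂ total c)
    ... | q , q< , oq≡c = q , subst (q <_) (length-total total) q< , oq≡c

    open Rigidity ℓ₁ ℓ₂ ℓ₁≤ℓ₂ o o-injective o-surjective o-closed o-rank

  nested⇒𝓛 : O ≡ 𝓛 ℓ₁ ℓ₂ ⊎ (ℓ₁ ≡ ℓ₂ × fstℕ (at d O 1) ≡ 1 × sndℕ (at d O 1) ≡ 0)
  nested⇒𝓛 with ℓ₁ ≟ ℓ₂ ×-dec fstℕ (o 1) ≟ 1 ×-dec sndℕ (o 1) ≟ 0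
  ... | yes exceptional = inj₂ exceptional
  ... | no regular = inj₁ (at-ext d O (𝓛 ℓ₁ ℓ₂) (trans (length-total total) (sym length-𝓛)) λ i i<n →
    lexIndex-injective (trans (lexIndex-o regular i (subst (i <_) (length-total total) i<n))
                              (sym (lexIndex-at d (subst (i <_) (length-total total) i<n)))))

rank-swap : ∀ {ℓ₁ ℓ₂} (x : 𝓜 ℓ₁ ℓ₂) → rank (swap x) ≡ rank x
rank-swap x = +-comm (sndℕ x) (fstℕ x)

map-swap-𝓛 : ∀ {ℓ₁ ℓ₂} → map swap (𝓛 ℓ₁ ℓ₂) ≡ 𝓒 ℓ₂ ℓ₁
map-swap-𝓛 {ℓ₁} {ℓ₂} = trans (map-concatMap swap (λ a → map (a ,_) (allFin ℓ₂)) (allFin ℓ₁))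
                   (concatMap-cong (λ a → sym (map-∘ (allFin ℓ₂))) (allFin ℓ₁))

map-swap-involutive : ∀ {ℓ₁ ℓ₂} (xs : List (𝓜 ℓ₁ ℓ₂)) → map swap (map swap xs) ≡ xs
map-swap-involutive xs = trans (sym (map-∘ xs)) (map-id xs)

swap-increasing : ∀ {ℓ₁ ℓ₂} {wt : Weight ℓ₁ ℓ₂} → RankIncreasing wt → RankIncreasing (wt ∘ swap)
swap-increasing increasing x y x<y = increasing (swap x) (swap y) (subst₂ _<_ (sym (rank-swap x)) (sym (rank-swap y)) x<y)

swap-constant : ∀ {ℓ₁ ℓ₂} {wt : Weight ℓ₁ ℓ₂} → RankConstant wt → RankConstant (wt ∘ swap)
swap-constant constant x y x≡y = constant (swap x) (swap y) (trans (rank-swap x) (trans x≡y (sym (rank-swap y))))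

swap-unique : ∀ {ℓ₁ ℓ₂} {xs : List (𝓜 ℓ₁ ℓ₂)} → Unique xs → Unique (map swap xs)
swap-unique = Unique.map⁺ (cong swap)

swap-total : ∀ {ℓ₁ ℓ₂} {O : List (𝓜 ℓ₁ ℓ₂)} → IsTotalOrder O → IsTotalOrder (map swap O)
swap-total (O! , all∈) = swap-unique O! , λ x → ∈-map⁺ swap (all∈ (swap x))

swap-downset : ∀ {ℓ₁ ℓ₂} {S : List (𝓜 ℓ₁ ℓ₂)} → IsDownset S → IsDownset (map swap S)
swap-downset {S = S} (S! , closed) = swap-unique S! , closed′
  where
  closed′ : ∀ x y → x ∈ map swap S → y ≼ x → y ∈ map swap S
  closed′ x y x∈ (a≤ , b≤) with ∈-map⁻ swap x∈
  ... | x′ , x′∈ , refl = ∈-map⁺ swap (closed x′ (swap y) x′∈ (b≤ , a≤))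

wtSum-map-swap : ∀ {ℓ₁ ℓ₂} (wt : Weight ℓ₂ ℓ₁) (xs : List (𝓜 ℓ₁ ℓ₂)) → wtSum wt (map swap xs) ≡ wtSum (wt ∘ swap) xs
wtSum-map-swap wt []       = refl
wtSum-map-swap wt (x ∷ xs) = cong (wt (swap x) ℚ.+_) (wtSum-map-swap wt xs)

swap-nested : ∀ {ℓ₁ ℓ₂} {wt : Weight ℓ₁ ℓ₂} {O : List (𝓜 ℓ₁ ℓ₂)} →
              GivesNestedSolutions wt O → GivesNestedSolutions (wt ∘ swap) (map swap O)
swap-nested {ℓ₁} {ℓ₂} {wt} {O} nested m m≤N =
  subst (IsOptimalDownset (wt ∘ swap)) (sym (take-map m O)) (swap-downset S-down , optimal)
  where
  S = take m O
  S-optimal = nested m (subst (m ≤_) (*-comm ℓ₂ ℓ₁) m≤N)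
  S-down = proj₁ S-optimal
  optimal : ∀ T → IsDownset T → length T ≡ length (map swap S) →
            wtSum (wt ∘ swap) T ℚ.≤ wtSum (wt ∘ swap) (map swap S)
  optimal T T-down |T| = subst₂ ℚ._≤_ (wtSum-map-swap wt T) (sym (wtSum-map-swap (wt ∘ swap) S))
    (proj₂ S-optimal (map swap T) (swap-downset T-down) (trans (length-map swap T) (trans |T| (length-map swap S))))

𝓛-linearExtension : ∀ {ℓ₁ ℓ₂} → IsLinearExtension (𝓛 ℓ₁ ℓ₂)
𝓛-linearExtension {ℓ₁} {ℓ₂} = (𝓛-unique , ∈𝓛) , λ i j c≼c′ → subst₂ _≤_ (position i) (position j) (lexIndex-mono c≼c′)
  where
  open Lex ℓ₁ ℓ₂
  position : ∀ i → lexIndex (lookup (𝓛 ℓ₁ ℓ₂) i) ≡ toℕ i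
  position i = trans (cong lexIndex (at-lookup (lookup (𝓛 ℓ₁ ℓ₂) i) (𝓛 ℓ₁ ℓ₂) i))
                     (lexIndex-at _ (subst (toℕ i <_) length-𝓛 (toℕ<n i)))
  lexIndex-mono : ∀ {c c′} → c ≼ c′ → lexIndex c ≤ lexIndex c′
  lexIndex-mono (a≤ , b≤) = +-mono-≤ (*-monoˡ-≤ ℓ₂ a≤) b≤

concatMap-singleton : ∀ {A B : Set} (f : A → B) xs → concatMap (λ x → [ f x ]) xs ≡ map f xs
concatMap-singleton f xs = trans (sym (concatMap-map [_] f xs)) (concatMap-pure (map f xs))

𝓛≡𝓒-thin : ∀ {ℓ₁ ℓ₂} → ℓ₁ ≡ 1 ⊎ ℓ₂ ≡ 1 → 𝓛 ℓ₁ ℓ₂ ≡ 𝓒 ℓ₁ ℓ₂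
𝓛≡𝓒-thin {ℓ₂ = ℓ₂} (inj₁ refl) = trans (++-identityʳ _) (sym (concatMap-singleton (zero ,_) (allFin ℓ₂)))
𝓛≡𝓒-thin {ℓ₁ = ℓ₁} (inj₂ refl) = trans (concatMap-singleton (_, zero) (allFin ℓ₁)) (sym (++-identityʳ _))

module Chain {ℓ₁ ℓ₂ : ℕ} (d : 𝓜 ℓ₁ ℓ₂)
  (rank-injective : ∀ {c c′ : 𝓜 ℓ₁ ℓ₂} → rank c ≡ rank c′ → c ≡ c′)
  (ranks-below    : ∀ (c : 𝓜 ℓ₁ ℓ₂) {r} → r < rank c → ∃ λ e → e ≼ c × rank e ≡ r)
  where

  open Grid ℓ₁ ℓ₂ using (length-total)

  module _ {O : List (𝓜 ℓ₁ ℓ₂)} (linear : IsLinearExtension O) where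

    private
      o = at d O

      order-reflecting : ∀ {i j} → i < length O → j < length O → o i ≼ o j → i ≤ j
      order-reflecting i< j< oi≼oj = subst₂ _≤_ (toℕ-fromℕ< i<) (toℕ-fromℕ< j<)
        (proj₂ linear (fromℕ< i<) (fromℕ< j<) (subst₂ _≼_ (o≡lookup i<) (o≡lookup j<) oi≼oj))
        where
        o≡lookup : ∀ {k} (k< : k < length O) → o k ≡ lookup O (fromℕ< k<)
        o≡lookup k< = trans (cong o (sym (toℕ-fromℕ< k<))) (sym (at-lookup d O (fromℕ< k<)))

    -- A smaller rank is already taken at an earlier position; a larger one has a cell of rank i
    -- below it, which would have to come earlier, where only smaller ranks occur.
    rank-at : ∀ i → i < length O → rank (o i) ≡ i
    rank-at = <-rec _ λ i ih i< → step i< (λ i′<i → ih i′<i (<-trans i′<i i<))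
      where
      step : ∀ {i} → i < length O → (∀ {i′} → i′ < i → rank (o i′) ≡ i′) → rank (o i) ≡ i
      step {i} i< ih with <-cmp (rank (o i)) i
      ... | tri≈ _ r≡i _ = r≡i
      ... | tri< r<i _ _ = ⊥-elim (<-irrefl (at-injective d O (proj₁ (proj₁ linear)) (<-trans r<i i<) i<
                                              (rank-injective (ih r<i))) r<i)
      ... | tri> _ _ i<r with ranks-below (o i) i<r
      ...   | e , e≼oi , re≡i with ∈⇒at d O (proj₂ (proj₁ linear) e)
      ...     | q , q< , oq≡e with m≤n⇒m<n∨m≡n (order-reflecting q< i< (subst (_≼ o i) (sym oq≡e) e≼oi))
      ...       | inj₁ q<i  = ⊥-elim (<-irrefl (trans (sym (ih q<i)) (trans (cong rank oq≡e) re≡i)) q<i)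
      ...       | inj₂ refl = ⊥-elim (<-irrefl (trans (sym re≡i) (cong rank (sym oq≡e))) i<r)

  linearExtension-unique : ∀ {O O′ : List (𝓜 ℓ₁ ℓ₂)} → IsLinearExtension O → IsLinearExtension O′ → O ≡ O′
  linearExtension-unique {O} {O′} linear linear′ = at-ext d O O′ |O|≡|O′| λ i i< →
    rank-injective (trans (rank-at linear i i<) (sym (rank-at linear′ i (subst (i <_) |O|≡|O′| i<))))
    where |O|≡|O′| = trans (length-total (proj₁ linear)) (sym (length-total (proj₁ linear′)))

thin-rank-injective : ∀ {ℓ₁ ℓ₂} → ℓ₁ ≡ 1 ⊎ ℓ₂ ≡ 1 → ∀ {c c′ : 𝓜 ℓ₁ ℓ₂} → rank c ≡ rank c′ → c ≡ c′
thin-rank-injective (inj₁ refl) {zero , _} {zero , _} eq = cong (zero ,_) (toℕ-injective eq)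
thin-rank-injective (inj₂ refl) {_ , zero} {_ , zero} eq =
  cong (_, zero) (toℕ-injective (trans (sym (+-identityʳ _)) (trans eq (+-identityʳ _))))

thin-ranks-below : ∀ {ℓ₁ ℓ₂} → ℓ₁ ≡ 1 ⊎ ℓ₂ ≡ 1 → ∀ (c : 𝓜 ℓ₁ ℓ₂) {r} → r < rank c → ∃ λ e → e ≼ c × rank e ≡ r
thin-ranks-below (inj₁ refl) (zero , b) {r} r<b =
  (zero , fromℕ< r<ℓ₂) , (z≤n , ≤-trans (≤-reflexive (toℕ-fromℕ< r<ℓ₂)) (<⇒≤ r<b)) , toℕ-fromℕ< r<ℓ₂
  where r<ℓ₂ = <-trans r<b (toℕ<n b)
thin-ranks-below (inj₂ refl) (a , zero) {r} r<a+0 =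
  (fromℕ< r<ℓ₁ , zero) , (≤-trans (≤-reflexive (toℕ-fromℕ< r<ℓ₁)) (<⇒≤ r<a) , z≤n)
                       , trans (+-identityʳ _) (toℕ-fromℕ< r<ℓ₁)
  where
  r<a = subst (r <_) (+-identityʳ (toℕ a)) r<a+0
  r<ℓ₁ = <-trans r<a (toℕ<n a)

module NestedSolutions {ℓ₁ ℓ₂ : ℕ} {wt : Weight ℓ₁ ℓ₂} (increasing : RankIncreasing wt) (constant : RankConstant wt) where

  𝓛-nested : ℓ₁ ≤ ℓ₂ → GivesNestedSolutions wt (𝓛 ℓ₁ ℓ₂)
  𝓛-nested ℓ₁≤ℓ₂ = Optimality.𝓛-nested ℓ₁ ℓ₂ ℓ₁≤ℓ₂ wt increasing constant

  𝓒-nested : ℓ₂ ≤ ℓ₁ → GivesNestedSolutions wt (𝓒 ℓ₁ ℓ₂)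
  𝓒-nested ℓ₂≤ℓ₁ = subst (GivesNestedSolutions wt) map-swap-𝓛
    (swap-nested {wt = wt ∘ swap}
      (Optimality.𝓛-nested ℓ₂ ℓ₁ ℓ₂≤ℓ₁ (wt ∘ swap) (swap-increasing increasing) (swap-constant constant)))

  module _ (d : 𝓜 ℓ₁ ℓ₂) {O : List (𝓜 ℓ₁ ℓ₂)} (total : IsTotalOrder O) (nested : GivesNestedSolutions wt O) where

    nested⇒𝓛 : ℓ₁ ≤ ℓ₂ → O ≡ 𝓛 ℓ₁ ℓ₂ ⊎ (ℓ₁ ≡ ℓ₂ × fstℕ (at d O 1) ≡ 1 × sndℕ (at d O 1) ≡ 0)
    nested⇒𝓛 ℓ₁≤ℓ₂ = Uniqueness.nested⇒𝓛 ℓ₁ ℓ₂ ℓ₁≤ℓ₂ d increasing constant total nested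

    nested⇒𝓒 : ℓ₂ ≤ ℓ₁ → O ≡ 𝓒 ℓ₁ ℓ₂ ⊎ (ℓ₂ ≡ ℓ₁ × sndℕ (at d O 1) ≡ 1 × fstℕ (at d O 1) ≡ 0)
    nested⇒𝓒 ℓ₂≤ℓ₁ with Uniqueness.nested⇒𝓛 ℓ₂ ℓ₁ ℓ₂≤ℓ₁ (swap d) (swap-increasing increasing) (swap-constant constant)
                           (swap-total total) (swap-nested {wt = wt} nested)
    ... | inj₁ O⊤≡𝓛 = inj₁ (begin
      O                         ≡⟨ map-swap-involutive O ⟨
      map swap (map swap O)     ≡⟨ cong (map swap) O⊤≡𝓛 ⟩
      map swap (𝓛 ℓ₂ ℓ₁)        ≡⟨ map-swap-𝓛 ⟩
      𝓒 ℓ₁ ℓ₂                   ∎)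
      where open ≡-Reasoning
    ... | inj₂ (ℓ₂≡ℓ₁ , a≡1 , b≡0) = inj₂ (ℓ₂≡ℓ₁ , trans (cong fstℕ o⊤1≡) a≡1 , trans (cong sndℕ o⊤1≡) b≡0)
      where
      o⊤1≡ : swap (at d O 1) ≡ at (swap d) (map swap O) 1
      o⊤1≡ = sym (at-map swap d O 1)

  nested⇔𝓛 : (d : 𝓜 ℓ₁ ℓ₂) → ℓ₁ < ℓ₂ → ∀ O → IsTotalOrder O → GivesNestedSolutions wt O ⇔ O ≡ 𝓛 ℓ₁ ℓ₂
  nested⇔𝓛 d ℓ₁<ℓ₂ O total = mk⇔ to λ O≡𝓛 → subst (GivesNestedSolutions wt) (sym O≡𝓛) (𝓛-nested (<⇒≤ ℓ₁<ℓ₂))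
    where
    to : GivesNestedSolutions wt O → O ≡ 𝓛 ℓ₁ ℓ₂
    to nested with nested⇒𝓛 d total nested (<⇒≤ ℓ₁<ℓ₂)
    ... | inj₁ O≡𝓛        = O≡𝓛
    ... | inj₂ (ℓ₁≡ℓ₂ , _) = contradiction ℓ₁≡ℓ₂ (<⇒≢ ℓ₁<ℓ₂)

  nested⇔𝓒 : (d : 𝓜 ℓ₁ ℓ₂) → ℓ₂ < ℓ₁ → ∀ O → IsTotalOrder O → GivesNestedSolutions wt O ⇔ O ≡ 𝓒 ℓ₁ ℓ₂
  nested⇔𝓒 d ℓ₂<ℓ₁ O total = mk⇔ to λ O≡𝓒 → subst (GivesNestedSolutions wt) (sym O≡𝓒) (𝓒-nested (<⇒≤ ℓ₂<ℓ₁))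
    where
    to : GivesNestedSolutions wt O → O ≡ 𝓒 ℓ₁ ℓ₂
    to nested with nested⇒𝓒 d total nested (<⇒≤ ℓ₂<ℓ₁)
    ... | inj₁ O≡𝓒        = O≡𝓒
    ... | inj₂ (ℓ₂≡ℓ₁ , _) = contradiction ℓ₂≡ℓ₁ (<⇒≢ ℓ₂<ℓ₁)

  -- On a square grid the exceptional second cells (1 , 0) and (0 , 1) exclude each other.
  nested⇔𝓛⊎𝓒 : (d : 𝓜 ℓ₁ ℓ₂) → ℓ₁ ≡ ℓ₂ → ∀ O → IsTotalOrder O →
               GivesNestedSolutions wt O ⇔ (O ≡ 𝓛 ℓ₁ ℓ₂ ⊎ O ≡ 𝓒 ℓ₁ ℓ₂)
  nested⇔𝓛⊎𝓒 d ℓ₁≡ℓ₂ O total = mk⇔ to from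
    where
    to : GivesNestedSolutions wt O → O ≡ 𝓛 ℓ₁ ℓ₂ ⊎ O ≡ 𝓒 ℓ₁ ℓ₂
    to nested with nested⇒𝓛 d total nested (≤-reflexive ℓ₁≡ℓ₂) | nested⇒𝓒 d total nested (≤-reflexive (sym ℓ₁≡ℓ₂))
    ... | inj₁ O≡𝓛 | _ = inj₁ O≡𝓛
    ... | inj₂ _   | inj₁ O≡𝓒 = inj₂ O≡𝓒
    ... | inj₂ (_ , _ , b≡0) | inj₂ (_ , b≡1 , _) = contradiction (trans (sym b≡0) b≡1) 0≢1+n
    from : O ≡ 𝓛 ℓ₁ ℓ₂ ⊎ O ≡ 𝓒 ℓ₁ ℓ₂ → GivesNestedSolutions wt O
    from (inj₁ O≡𝓛) = subst (GivesNestedSolutions wt) (sym O≡𝓛) (𝓛-nested (≤-reflexive ℓ₁≡ℓ₂))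
    from (inj₂ O≡𝓒) = subst (GivesNestedSolutions wt) (sym O≡𝓒) (𝓒-nested (≤-reflexive (sym ℓ₁≡ℓ₂)))

  thin-grid : 1 ≤ ℓ₁ → 1 ≤ ℓ₂ → ℓ₁ ≡ 1 ⊎ ℓ₂ ≡ 1 →
      IsLinearExtension (𝓛 ℓ₁ ℓ₂)
    × ((O O′ : List (𝓜 ℓ₁ ℓ₂)) → IsLinearExtension O → IsLinearExtension O′ → O ≡ O′)
    × (𝓛 ℓ₁ ℓ₂ ≡ 𝓒 ℓ₁ ℓ₂)
    × ((O : List (𝓜 ℓ₁ ℓ₂)) → IsTotalOrder O → (GivesNestedSolutions wt O ⇔ (O ≡ 𝓛 ℓ₁ ℓ₂ ⊎ O ≡ 𝓒 ℓ₁ ℓ₂)))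
  thin-grid 1≤ℓ₁ 1≤ℓ₂ thin =
    𝓛-linearExtension , (λ _ _ → linearExtension-unique) , 𝓛≡𝓒 , nested⇔
    where
    d = cell 1≤ℓ₁ 1≤ℓ₂
    open Chain d (thin-rank-injective thin) (thin-ranks-below thin)
    𝓛≡𝓒 = 𝓛≡𝓒-thin thin
    either : ∀ {P : Set} {O : List (𝓜 ℓ₁ ℓ₂)} → P ⇔ O ≡ 𝓛 ℓ₁ ℓ₂ → P ⇔ (O ≡ 𝓛 ℓ₁ ℓ₂ ⊎ O ≡ 𝓒 ℓ₁ ℓ₂)
    either P⇔ = mk⇔ (inj₁ ∘ Equivalence.to P⇔)
                    (⊎-elim (Equivalence.from P⇔) (λ O≡𝓒 → Equivalence.from P⇔ (trans O≡𝓒 (sym 𝓛≡𝓒))))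
    nested⇔ : ∀ O → IsTotalOrder O → GivesNestedSolutions wt O ⇔ (O ≡ 𝓛 ℓ₁ ℓ₂ ⊎ O ≡ 𝓒 ℓ₁ ℓ₂)
    nested⇔ O total with <-cmp ℓ₁ ℓ₂
    ... | tri< ℓ₁<ℓ₂ _ _ = either (nested⇔𝓛 d ℓ₁<ℓ₂ O total)
    ... | tri≈ _ ℓ₁≡ℓ₂ _ = nested⇔𝓛⊎𝓒 d ℓ₁≡ℓ₂ O total
    ... | tri> _ _ ℓ₂<ℓ₁ =
      either (subst (λ L → GivesNestedSolutions wt O ⇔ O ≡ L) (sym 𝓛≡𝓒) (nested⇔𝓒 d ℓ₂<ℓ₁ O total))

corollary4p7 : (ℓ₁ ℓ₂ : ℕ) → 1 ≤ ℓ₁ → 1 ≤ ℓ₂ → (wt : Weight ℓ₁ ℓ₂) →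
    RankIncreasing wt → RankConstant wt →
    ((ℓ₁ ≡ ℓ₂) → (O : List (𝓜 ℓ₁ ℓ₂)) → IsTotalOrder O →
        (GivesNestedSolutions wt O ⇔ (O ≡ 𝓛 ℓ₁ ℓ₂ ⊎ O ≡ 𝓒 ℓ₁ ℓ₂)))
    × ((ℓ₁ ≡ 1 ⊎ ℓ₂ ≡ 1) →
        (IsLinearExtension (𝓛 ℓ₁ ℓ₂)
          × ((O O′ : List (𝓜 ℓ₁ ℓ₂)) → IsLinearExtension O → IsLinearExtension O′ → O ≡ O′)
          × (𝓛 ℓ₁ ℓ₂ ≡ 𝓒 ℓ₁ ℓ₂)
          × ((O : List (𝓜 ℓ₁ ℓ₂)) → IsTotalOrder O →
              (GivesNestedSolutions wt O ⇔ (O ≡ 𝓛 ℓ₁ ℓ₂ ⊎ O ≡ 𝓒 ℓ₁ ℓ₂)))))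
    × ((1 < ℓ₁ → ℓ₁ < ℓ₂ → (O : List (𝓜 ℓ₁ ℓ₂)) → IsTotalOrder O →
        (GivesNestedSolutions wt O ⇔ O ≡ 𝓛 ℓ₁ ℓ₂)))
    × ((1 < ℓ₂ → ℓ₂ < ℓ₁ → (O : List (𝓜 ℓ₁ ℓ₂)) → IsTotalOrder O →
        (GivesNestedSolutions wt O ⇔ O ≡ 𝓒 ℓ₁ ℓ₂)))
-- Parts (3) and (4) hold without their hypotheses 1 < ℓ₁ and 1 < ℓ₂.
corollary4p7 ℓ₁ ℓ₂ 1≤ℓ₁ 1≤ℓ₂ wt increasing constant =
    nested⇔𝓛⊎𝓒 d
  , thin-grid 1≤ℓ₁ 1≤ℓ₂
  , (λ _ → nested⇔𝓛 d)
  , (λ _ → nested⇔𝓒 d)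
  where
  open NestedSolutions increasing constant
  d = cell 1≤ℓ₁ 1≤ℓ₂
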